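{- Let $q_0$ be a rational number such that neither $2+q_0$ nor $2-q_0$ is a rational square. Then for every $k=1,2,\dots$ and $s=0,1,2,\dots$, $Z_k\cap\{p: 2^{k+s}\,\|\,\widehat p\}\subset\Pi_{s+2}(q_0)$.
   Context: Chebyshev polynomials: $U_0=0$, $U_1=1$, $U_{n+1}=qU_n-U_{n-1}$; $C_n=U_{n+1}-U_{n-1}$. For a rational $q$ and an odd prime $p$ not dividing the denominator of $q$ (congruences in $\mathbb F_p$): $p\in\Pi_{2+k}(q)$ ($k\ge0$) if $C_{2^kn}(q)\equiv0\bmod p$ for some odd $n\ge1$. Legendre symbol of a rational $x=a/b$ (lowest terms) at an odd prime $p\nmid b$: $(x|p)=1$ if $ab$ is a nonzero square mod $p$, $-1$ if a nonsquare, $0$ if $p\mid a$. Let $\delta=q_0^2-4$, let $\Pi'$ be the set of odd primes dividing neither the numerator nor the denominator of $\delta$, and for $p\in\Pi'$ put $\widehat p=\frac{p-(\delta|p)}{2}$. For $s\ge1$, $\Omega_s^{\pm}=\{p\in\Pi': C_{2^s}(a)\equiv\pm q_0 \bmod p \text{ for some } a\in\mathbb F_p\}$, and $\Omega_0^\pm=\Pi'$. $R_k=\Omega_k^+\cap\Omega_k^-$, $Z_k=R_{k-1}\setminus(\Omega_k^+\cup\Omega_k^-)$. $2^j\,\|\,m$ means $2^j\mid m$ and $2^{j+1}\nmid m$. -}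

module Defs where

open import Data.Nat as ℕ using (ℕ; zero; suc; _<_; _^_)
import Data.Nat.Divisibility as ℕD
open import Data.Nat.Primality using (Prime)
open import Data.Integer as ℤ using (ℤ; +_; -[1+_])
open import Data.Integer.Divisibility using () renaming (_∣_ to _∣ℤ_)
open import Data.Rational as ℚ using (ℚ; ↥_; ↧_; 0ℚ; 1ℚ; _/_)
open import Data.Product using (Σ; ∃; ∃-syntax; _×_)
open import Data.Sum using (_⊎_)
open import Relation.Nullary using (¬_)
open import Relation.Binary.PropositionalEquality using (_≡_)

U : ℕ → ℚ → ℚ
U zero q = 0ℚ
U (suc zero) q = 1ℚ
U (suc (suc n)) q = q ℚ.* U (suc n) q ℚ.- U n q

-- C_n = U_{n+1} - U_{n-1}, with U_{-1} = -U_1 = -1, so C_0 = 2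
C : ℕ → ℚ → ℚ
C zero q = + 2 / 1
C (suc n) q = U (suc (suc n)) q ℚ.- U n q

-- the rational x is ≡ 0 mod p (for p not dividing its denominator)
_∣ℚ_ : ℕ → ℚ → Set
p ∣ℚ x = (+ p) ∣ℤ (↥ x)

_≡[_]_ : ℚ → ℕ → ℚ → Set
x ≡[ p ] y = p ∣ℚ (x ℚ.- y)

OddPrime : ℕ → Set
OddPrime p = Prime p × ¬ (2 ℕD.∣ p)

_∥_ : ℕ → ℕ → Set
j ∥ m = ((2 ^ j) ℕD.∣ m) × ¬ ((2 ^ suc j) ℕD.∣ m)

IsSquareℚ : ℚ → Set
IsSquareℚ x = ∃[ r ] (r ℚ.* r ≡ x)

-- p ∈ Π_{2+k}(q)
Π : ℕ → ℚ → ℕ → Set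
Π k q p = OddPrime p × ¬ (+ p ∣ℤ ↧ q)
        × ∃[ n ] (¬ (2 ℕD.∣ n) × p ∣ℚ C (2 ^ k ℕ.* n) q)

-- x = a/b is a (possibly zero) square mod p: a*b ≡ y² for some y
SqModP : ℚ → ℕ → Set
SqModP x p = ∃[ y ] ((+ p) ∣ℤ ((y ℤ.* y) ℤ.- (↥ x ℤ.* ↧ x)))

Legendre : ℚ → ℕ → ℤ → Set
Legendre x p l =
    (l ≡ + 1 × ¬ (p ∣ℚ x) × SqModP x p)
  ⊎ (l ≡ -[1+ 0 ] × ¬ (p ∣ℚ x) × ¬ SqModP x p)
  ⊎ (l ≡ + 0 × p ∣ℚ x)

δ : ℚ → ℚ
δ q₀ = q₀ ℚ.* q₀ ℚ.- (+ 4 / 1)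

Π' : ℚ → ℕ → Set
Π' q₀ p = OddPrime p × ¬ (+ p ∣ℤ ↥ δ q₀) × ¬ (+ p ∣ℤ ↧ δ q₀)

-- h = p̂ = (p - (δ|p))/2, i.e. 2h + (δ|p) = p
IsHat : ℚ → ℕ → ℕ → Set
IsHat q₀ p h = ∃[ l ] (Legendre (δ q₀) p l × (+ (2 ℕ.* h) ℤ.+ l ≡ + p))

data Sign : Set where
  plus minus : Sign

signed : Sign → ℚ → ℚ
signed plus x = x
signed minus x = ℚ.- x

Ω : Sign → ℕ → ℚ → ℕ → Set
Ω σ zero q₀ p = Π' q₀ p
Ω σ (suc s) q₀ p = Π' q₀ p
  × ∃[ a ] (a < p × C (2 ^ suc s) (+ a / 1) ≡[ p ] signed σ q₀)

R : ℕ → ℚ → ℕ → Set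
R k q₀ p = Ω plus k q₀ p × Ω minus k q₀ p

-- Z_k for k ≥ 1 (Z (suc k) is Z_{k+1})
Z : ℕ → ℚ → ℕ → Set
Z k q₀ p = R (ℕ.pred k) q₀ p × ¬ Ω plus k q₀ p × ¬ Ω minus k q₀ p

{-# OPTIONS --safe #-}
-- Let p = 2m + 1 lie in Z_k, with 2^(k+s) ∥ p̂, and reduce q₀ to r₀ ∈ 𝔽_p.  As p ∈ R_{k-1} there is
-- a ∈ 𝔽_p with C_K(a) = r₀, K = 2^(k-1); as p ∉ Ω_k⁺, a + 2 is a non-square, since a = y² − 2 = C₂(y)
-- would give C_{2K}(y) = r₀.  Work in 𝔽_p[X]/(X² − aX + 1), where C_n(a) = Xⁿ + X⁻ⁿ.  The square
-- class of δ ≡ (a² − 4)·U_K(a)² decides, by Euler's criterion, whether Frobenius fixes X or inverts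
-- it; comparing (1 + X)^(p+1) = ((a + 2)X)^(m+1), with (a + 2)^m = −1, against (1 + X)(1 + X^p)
-- then gives X^p̂ = −1.  Writing p̂ = 2KN with N = 2^s·(odd), this is C_{KN}(a) = 0, and
-- C_N(q₀) ≡ C_N(C_K(a)) = C_{KN}(a) ≡ 0 (mod p), i.e. p ∈ Π_{s+2}(q₀).
module Submission where

open import Data.Nat as ℕ using (ℕ; zero; suc)
open import Data.Integer as ℤ using (ℤ)
open import Data.Nat.Primality using (Prime)

module BinomialFrobenius where

  open import Data.Nat using (_≤_; _<_; z≤n; s≤s; _∸_; _!; nonTrivial⇒n>1)
  import Data.Nat.Properties as ℕP
  open import Data.Nat.Divisibility using (_∣_; divides; ∣⇒≤; ∣1⇒≡1)
  open import Data.Nat.DivMod using (m/n*n≡m)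
  open import Data.Nat.Primality using (Prime; euclidsLemma; prime⇒nonTrivial)
  open import Data.Nat.Combinatorics using (_C_; nCk≡n!/k![n-k]!; k![n∸k]!∣n!; nCn≡1)
  open import Data.Fin as Fin using (Fin; toℕ; fromℕ; inject₁)
  import Data.Fin.Properties as FinP
  open import Data.Product using (∃-syntax; _,_)
  open import Data.Sum using (inj₁; inj₂)
  open import Data.Empty using (⊥-elim)
  open import Relation.Binary.PropositionalEquality as ≡ using (_≡_)
  open import Algebra.Bundles using (CommutativeSemiring)
  open import Data.Vec.Functional using (Vector; init; last; tail)

  prime>1 : ∀ {p} → Prime p → 1 < p
  prime>1 {p} pr = nonTrivial⇒n>1 p {{prime⇒nonTrivial pr}}

  prime∣!⇒≤ : ∀ {p} → Prime p → ∀ n → p ∣ n ! → p ≤ n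
  prime∣!⇒≤ pr zero p∣1 = ⊥-elim (ℕP.<⇒≢ (prime>1 pr) (≡.sym (∣1⇒≡1 p∣1)))
  prime∣!⇒≤ pr (suc n) p∣n! with euclidsLemma (suc n) (n !) pr p∣n!
  ... | inj₁ p∣1+n = ∣⇒≤ p∣1+n
  ... | inj₂ p∣n! = ℕP.m≤n⇒m≤1+n (prime∣!⇒≤ pr n p∣n!)

  n∣n! : ∀ n → 1 ≤ n → n ∣ n !
  n∣n! (suc n) _ = divides (n !) (ℕP.*-comm (suc n) (n !))

  prime∣binomial : ∀ {p} → Prime p → ∀ k → 0 < k → k < p → p ∣ p C k
  prime∣binomial {p} pr k 0<k k<p with euclidsLemma (p C k) (k ! ℕ.* (p ∸ k) !) pr p∣product
    where
    instance _ = k ℕP.!* (p ∸ k) !≢0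
    p∣product : p ∣ (p C k) ℕ.* (k ! ℕ.* (p ∸ k) !)
    p∣product = ≡.subst (p ∣_)
      (≡.sym (≡.trans (≡.cong (ℕ._* (k ! ℕ.* (p ∸ k) !)) (nCk≡n!/k![n-k]! (ℕP.<⇒≤ k<p)))
                      (m/n*n≡m (k![n∸k]!∣n! (ℕP.<⇒≤ k<p)))))
      (n∣n! p (ℕP.<-trans 0<k k<p))
  ... | inj₁ p∣pCk = p∣pCk
  ... | inj₂ p∣k![p∸k]! with euclidsLemma (k !) ((p ∸ k) !) pr p∣k![p∸k]!
  ...   | inj₁ p∣k! = ⊥-elim (ℕP.<⇒≱ k<p (prime∣!⇒≤ pr k p∣k!))
  ...   | inj₂ p∣[p∸k]! = ⊥-elim (ℕP.<⇒≱ (ℕP.∸-monoʳ-< 0<k (ℕP.<⇒≤ k<p)) (prime∣!⇒≤ pr (p ∸ k) p∣[p∸k]!))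

  module _ {c ℓ} (S : CommutativeSemiring c ℓ) where
    open CommutativeSemiring S
    open import Algebra.Properties.CommutativeSemiring.Binomial S using (theorem; binomialTerm; binomial)
    open import Algebra.Properties.Semiring.Exp semiring using (_^_)
    open import Algebra.Properties.Monoid.Mult +-monoid using (_×_; ×-assocˡ; ×-congʳ)
    open import Algebra.Properties.Semiring.Mult semiring using (×-assoc-*)
    open import Algebra.Properties.Monoid.Sum +-monoid using (sum; sum-init-last; sum-cong-≋)
    open import Algebra.Properties.Semiring.Sum semiring using (*-distribˡ-sum)
    open import Relation.Binary.Reasoning.Setoid setoid

    ×≈×1#* : ∀ n y → n × y ≈ (n × 1#) * y
    ×≈×1#* n y = sym (trans (×-assoc-* n 1# y) (×-congʳ n (*-identityˡ y)))

    freshmans-dream : ∀ {n} → Prime (suc n) → ∀ x y →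
                      ∃[ w ] (x + y) ^ suc n ≈ (x ^ suc n + y ^ suc n) + (suc n × 1#) * w
    freshmans-dream {n} pr x y = sum g , expansion
      where
      p = suc n
      T : Vector Carrier (suc p)
      T = binomialTerm x y p
      q : Fin n → ℕ
      q i = _∣_.quotient (prime∣binomial pr (suc (toℕ i)) (s≤s z≤n) (s≤s (FinP.toℕ<n i)))
      p∣inner : ∀ i → p C suc (toℕ i) ≡ p ℕ.* q i
      p∣inner i = ≡.trans (_∣_.equality (prime∣binomial pr (suc (toℕ i)) (s≤s z≤n) (s≤s (FinP.toℕ<n i))))
                          (ℕP.*-comm (q i) p)
      b : Fin n → Carrier
      b i = binomial x y p (Fin.suc (inject₁ i))
      g : Fin n → Carrier
      g i = q i × b i
      inner : ∀ i → init (tail T) i ≈ (p × 1#) * g i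
      inner i = begin
        (p C suc (toℕ (inject₁ i))) × b i ≡⟨ ≡.cong (λ j → (p C suc j) × b i) (FinP.toℕ-inject₁ i) ⟩
        (p C suc (toℕ i)) × b i           ≡⟨ ≡.cong (_× b i) (p∣inner i) ⟩
        (p ℕ.* q i) × b i                 ≈⟨ sym (×-assocˡ (b i) p (q i)) ⟩
        p × g i                           ≈⟨ ×≈×1#* p (g i) ⟩
        (p × 1#) * g i                    ∎
      first : T Fin.zero ≈ y ^ p
      first = trans (+-identityʳ _) (*-identityˡ _)
      final : last (tail T) ≈ x ^ p
      final = begin
        (p C toℕ (fromℕ p)) × (x ^ toℕ (fromℕ p) * y ^ (p ∸ toℕ (fromℕ p)))
          ≡⟨ ≡.cong (λ j → (p C j) × (x ^ j * y ^ (p ∸ j))) (FinP.toℕ-fromℕ p) ⟩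
        (p C p) × (x ^ p * y ^ (p ∸ p))
          ≡⟨ ≡.cong₂ (λ c e → c × (x ^ p * y ^ e)) (nCn≡1 p) (ℕP.n∸n≡0 p) ⟩
        1 × (x ^ p * 1#) ≈⟨ trans (+-identityʳ _) (*-identityʳ _) ⟩
        x ^ p ∎
      expansion : (x + y) ^ p ≈ (x ^ p + y ^ p) + (p × 1#) * sum g
      expansion = begin
        (x + y) ^ p                                        ≈⟨ theorem p x y ⟩
        T Fin.zero + sum (tail T)                          ≈⟨ +-congˡ (sum-init-last (tail T)) ⟩
        T Fin.zero + (sum (init (tail T)) + last (tail T)) ≈⟨ +-cong first (+-cong (sum-cong-≋ inner) final) ⟩
        y ^ p + (sum (λ i → (p × 1#) * g i) + x ^ p)       ≈⟨ +-congˡ (+-congʳ (sym (*-distribˡ-sum (p × 1#) g))) ⟩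
        y ^ p + ((p × 1#) * sum g + x ^ p)                 ≈⟨ +-congˡ (+-comm _ _) ⟩
        y ^ p + (x ^ p + (p × 1#) * sum g)                 ≈⟨ sym (+-assoc _ _ _) ⟩
        (y ^ p + x ^ p) + (p × 1#) * sum g                 ≈⟨ +-congʳ (+-comm _ _) ⟩
        (x ^ p + y ^ p) + (p × 1#) * sum g                 ∎

module Chebyshev where

  import Data.Nat.Properties as ℕP
  import Data.Nat.Tactic.RingSolver as ℕSolver
  open import Data.Integer using (+_; _+_; _*_; _-_; -_; 0ℤ; 1ℤ)
  open import Data.Integer.Tactic.RingSolver using (solve-∀)
  open import Relation.Binary.PropositionalEquality using (_≡_; sym; trans; cong; cong₂; module ≡-Reasoning)

  Uℤ : ℕ → ℤ → ℤ
  Uℤ zero a = 0ℤ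
  Uℤ (suc zero) a = 1ℤ
  Uℤ (suc (suc n)) a = a * Uℤ (suc n) a - Uℤ n a

  Cℤ : ℕ → ℤ → ℤ
  Cℤ zero a = + 2
  Cℤ (suc n) a = Uℤ (suc (suc n)) a - Uℤ n a

  Cℤ-1 : ∀ a → Cℤ 1 a ≡ a
  Cℤ-1 = normalise
    where normalise : ∀ a → a * 1ℤ - 0ℤ - 0ℤ ≡ a
          normalise = solve-∀

  Cℤ-recurrence : ∀ n a → Cℤ (suc (suc n)) a ≡ a * Cℤ (suc n) a - Cℤ n a
  Cℤ-recurrence zero = normalise
    where normalise : ∀ a → (a * (a * 1ℤ - 0ℤ) - 1ℤ) - 1ℤ ≡ a * (a * 1ℤ - 0ℤ - 0ℤ) - + 2
          normalise = solve-∀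
  Cℤ-recurrence (suc n) a = expand a (Uℤ (suc n) a) (Uℤ n a)
    where expand : ∀ a u₁ u₀ → (a * (a * (a * u₁ - u₀) - u₁) - (a * u₁ - u₀)) - (a * u₁ - u₀)
                               ≡ a * ((a * (a * u₁ - u₀) - u₁) - u₁) - ((a * u₁ - u₀) - u₀)
          expand = solve-∀

  Cℤ-2 : ∀ a → Cℤ 2 a ≡ a * a - + 2
  Cℤ-2 a = trans (Cℤ-recurrence 0 a) (cong (λ c → a * c - + 2) (Cℤ-1 a))

  cassini : ∀ n a → Uℤ (suc n) a * Uℤ (suc n) a - a * Uℤ (suc n) a * Uℤ n a + Uℤ n a * Uℤ n a ≡ 1ℤ
  cassini zero = normalise
    where normalise : ∀ a → 1ℤ * 1ℤ - a * 1ℤ * 0ℤ + 0ℤ * 0ℤ ≡ 1ℤ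
          normalise = solve-∀
  cassini (suc n) a = trans (step a (Uℤ (suc n) a) (Uℤ n a)) (cassini n a)
    where step : ∀ a u₁ u₀ → (a * u₁ - u₀) * (a * u₁ - u₀) - a * (a * u₁ - u₀) * u₁ + u₁ * u₁
                             ≡ u₁ * u₁ - a * u₁ * u₀ + u₀ * u₀
          step = solve-∀

  Cℤ²-4 : ∀ n a → Cℤ n a * Cℤ n a - + 4 ≡ (a * a - + 4) * (Uℤ n a * Uℤ n a)
  Cℤ²-4 zero = normalise
    where normalise : ∀ a → + 2 * + 2 - + 4 ≡ (a * a - + 4) * (0ℤ * 0ℤ)
          normalise = solve-∀
  Cℤ²-4 (suc n) a = begin
    Cℤ (suc n) a * Cℤ (suc n) a - + 4                       ≡⟨ expand a u₁ u₀ ⟩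
    (a * a - + 4) * (u₁ * u₁) + + 4 * (cassini-form - 1ℤ)   ≡⟨ cong (λ k → (a * a - + 4) * (u₁ * u₁) + + 4 * (k - 1ℤ))
                                                                    (cassini n a) ⟩
    (a * a - + 4) * (u₁ * u₁) + + 4 * (1ℤ - 1ℤ)             ≡⟨ vanish ((a * a - + 4) * (u₁ * u₁)) ⟩
    (a * a - + 4) * (u₁ * u₁)                               ∎
    where
    open ≡-Reasoning
    u₁ = Uℤ (suc n) a
    u₀ = Uℤ n a
    cassini-form = u₁ * u₁ - a * u₁ * u₀ + u₀ * u₀
    expand : ∀ a u₁ u₀ → ((a * u₁ - u₀) - u₀) * ((a * u₁ - u₀) - u₀) - + 4
                         ≡ (a * a - + 4) * (u₁ * u₁) + + 4 * ((u₁ * u₁ - a * u₁ * u₀ + u₀ * u₀) - 1ℤ)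
    expand = solve-∀
    vanish : ∀ x → x + + 4 * (1ℤ - 1ℤ) ≡ x
    vanish = solve-∀

  Cℤ-congˡ : ∀ {j k} a → j ≡ k → Cℤ j a ≡ Cℤ k a
  Cℤ-congˡ a = cong (λ k → Cℤ k a)

  Cℤ-product-step : ∀ i d a →
    Cℤ (suc i) a * Cℤ (suc i ℕ.+ suc d) a ≡ Cℤ (suc i ℕ.+ suc i ℕ.+ suc d) a + Cℤ (suc d) a →
    Cℤ i a * Cℤ (i ℕ.+ (2 ℕ.+ d)) a ≡ Cℤ (i ℕ.+ i ℕ.+ (2 ℕ.+ d)) a + Cℤ (2 ℕ.+ d) a →
    Cℤ (2 ℕ.+ i) a * Cℤ (2 ℕ.+ i ℕ.+ d) a ≡ Cℤ (2 ℕ.+ i ℕ.+ (2 ℕ.+ i) ℕ.+ d) a + Cℤ d a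
  Cℤ-product-step i d a IH₁ IH₀ = begin
    Cℤ (2 ℕ.+ i) a * E                               ≡⟨ cong (_* E) (Cℤ-recurrence i a) ⟩
    (a * Cℤ (suc i) a - Cℤ i a) * E                  ≡⟨ distribute a (Cℤ (suc i) a) (Cℤ i a) E ⟩
    a * (Cℤ (suc i) a * E) - Cℤ i a * E              ≡⟨ cong₂ (λ x y → a * x - y) product₁ product₀ ⟩
    a * (Cℤ (3 ℕ.+ j) a + Cℤ (suc d) a) - (Cℤ (2 ℕ.+ j) a + Cℤ (2 ℕ.+ d) a)
                                                     ≡⟨ cong (λ c → a * (Cℤ (3 ℕ.+ j) a + Cℤ (suc d) a) - (Cℤ (2 ℕ.+ j) a + c))
                                                             (Cℤ-recurrence d a) ⟩
    a * (Cℤ (3 ℕ.+ j) a + Cℤ (suc d) a) - (Cℤ (2 ℕ.+ j) a + (a * Cℤ (suc d) a - Cℤ d a))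
                                                     ≡⟨ regroup a (Cℤ (2 ℕ.+ j) a) (Cℤ (3 ℕ.+ j) a) (Cℤ d a) (Cℤ (suc d) a) ⟩
    (a * Cℤ (3 ℕ.+ j) a - Cℤ (2 ℕ.+ j) a) + Cℤ d a   ≡⟨ cong (_+ Cℤ d a) (sym (Cℤ-recurrence (2 ℕ.+ j) a)) ⟩
    Cℤ (4 ℕ.+ j) a + Cℤ d a                          ≡⟨ cong (_+ Cℤ d a) (Cℤ-congˡ a (index₄ i d)) ⟩
    Cℤ (2 ℕ.+ i ℕ.+ (2 ℕ.+ i) ℕ.+ d) a + Cℤ d a      ∎
    where
    open ≡-Reasoning
    j = i ℕ.+ i ℕ.+ d
    E = Cℤ (2 ℕ.+ i ℕ.+ d) a
    index₁ : ∀ i d → suc i ℕ.+ suc d ≡ 2 ℕ.+ i ℕ.+ d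
    index₁ = ℕSolver.solve-∀
    index₁′ : ∀ i d → suc i ℕ.+ suc i ℕ.+ suc d ≡ 3 ℕ.+ (i ℕ.+ i ℕ.+ d)
    index₁′ = ℕSolver.solve-∀
    index₀ : ∀ i d → i ℕ.+ (2 ℕ.+ d) ≡ 2 ℕ.+ i ℕ.+ d
    index₀ = ℕSolver.solve-∀
    index₀′ : ∀ i d → i ℕ.+ i ℕ.+ (2 ℕ.+ d) ≡ 2 ℕ.+ (i ℕ.+ i ℕ.+ d)
    index₀′ = ℕSolver.solve-∀
    index₄ : ∀ i d → 4 ℕ.+ (i ℕ.+ i ℕ.+ d) ≡ 2 ℕ.+ i ℕ.+ (2 ℕ.+ i) ℕ.+ d
    index₄ = ℕSolver.solve-∀
    product₁ : Cℤ (suc i) a * E ≡ Cℤ (3 ℕ.+ j) a + Cℤ (suc d) a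
    product₁ = trans (cong (Cℤ (suc i) a *_) (Cℤ-congˡ a (sym (index₁ i d))))
                     (trans IH₁ (cong (_+ Cℤ (suc d) a) (Cℤ-congˡ a (index₁′ i d))))
    product₀ : Cℤ i a * E ≡ Cℤ (2 ℕ.+ j) a + Cℤ (2 ℕ.+ d) a
    product₀ = trans (cong (Cℤ i a *_) (Cℤ-congˡ a (sym (index₀ i d))))
                     (trans IH₀ (cong (_+ Cℤ (2 ℕ.+ d) a) (Cℤ-congˡ a (index₀′ i d))))
    distribute : ∀ a x y e → (a * x - y) * e ≡ a * (x * e) - y * e
    distribute = solve-∀
    regroup : ∀ a c₂ c₃ c₀ c₁ → a * (c₃ + c₁) - (c₂ + (a * c₁ - c₀)) ≡ (a * c₃ - c₂) + c₀
    regroup = solve-∀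

  Cℤ-product : ∀ i d a → Cℤ i a * Cℤ (i ℕ.+ d) a ≡ Cℤ (i ℕ.+ i ℕ.+ d) a + Cℤ d a
  Cℤ-product zero d a = double (Cℤ d a)
    where double : ∀ x → + 2 * x ≡ x + x
          double = solve-∀
  Cℤ-product (suc zero) d a = begin
    Cℤ 1 a * Cℤ (suc d) a                            ≡⟨ cong (_* Cℤ (suc d) a) (Cℤ-1 a) ⟩
    a * Cℤ (suc d) a                                 ≡⟨ regroup (a * Cℤ (suc d) a) (Cℤ d a) ⟩
    (a * Cℤ (suc d) a - Cℤ d a) + Cℤ d a             ≡⟨ cong (_+ Cℤ d a) (sym (Cℤ-recurrence d a)) ⟩
    Cℤ (suc (suc d)) a + Cℤ d a                      ∎
    where
    open ≡-Reasoning
    regroup : ∀ x y → x ≡ (x - y) + y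
    regroup = solve-∀
  Cℤ-product (suc (suc i)) d a =
    Cℤ-product-step i d a (Cℤ-product (suc i) (suc d) a) (Cℤ-product i (2 ℕ.+ d) a)

  Cℤ-∘ : ∀ M N a → Cℤ M (Cℤ N a) ≡ Cℤ (N ℕ.* M) a
  Cℤ-∘ zero N a = Cℤ-congˡ a (sym (ℕP.*-zeroʳ N))
  Cℤ-∘ (suc zero) N a = trans (Cℤ-1 (Cℤ N a)) (Cℤ-congˡ a (sym (ℕP.*-identityʳ N)))
  Cℤ-∘ (suc (suc M)) N a = begin
    Cℤ (2 ℕ.+ M) b                                    ≡⟨ Cℤ-recurrence M b ⟩
    b * Cℤ (suc M) b - Cℤ M b                         ≡⟨ cong₂ (λ x y → b * x - y) (Cℤ-∘ (suc M) N a) (Cℤ-∘ M N a) ⟩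
    b * Cℤ (N ℕ.* suc M) a - Cℤ (N ℕ.* M) a           ≡⟨ cong (λ c → b * c - Cℤ (N ℕ.* M) a) (Cℤ-congˡ a (ℕP.*-suc N M)) ⟩
    b * Cℤ (N ℕ.+ N ℕ.* M) a - Cℤ (N ℕ.* M) a         ≡⟨ cong (_- Cℤ (N ℕ.* M) a) (Cℤ-product N (N ℕ.* M) a) ⟩
    (Cℤ (N ℕ.+ N ℕ.+ N ℕ.* M) a + Cℤ (N ℕ.* M) a) - Cℤ (N ℕ.* M) a
                                                      ≡⟨ cancel (Cℤ (N ℕ.+ N ℕ.+ N ℕ.* M) a) (Cℤ (N ℕ.* M) a) ⟩
    Cℤ (N ℕ.+ N ℕ.+ N ℕ.* M) a                        ≡⟨ Cℤ-congˡ a (index N M) ⟩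
    Cℤ (N ℕ.* suc (suc M)) a                          ∎
    where
    open ≡-Reasoning
    b = Cℤ N a
    cancel : ∀ x y → (x + y) - y ≡ x
    cancel = solve-∀
    index : ∀ N M → N ℕ.+ N ℕ.+ N ℕ.* M ≡ N ℕ.* suc (suc M)
    index = ℕSolver.solve-∀

module Congruence (p : ℕ) where

  open import Data.Integer using (ℤ; +_; _+_; _*_; _-_; -_; 0ℤ; _^_)
  import Data.Integer.Properties as ℤP
  open import Data.Integer.Divisibility.Signed using (_∣_; divides; ∣m∣n⇒∣m+n; ∣m⇒∣-m; ∣n⇒∣m*n)
  open import Data.Integer.Tactic.RingSolver using (solve-∀)
  open import Relation.Binary.Bundles using (Setoid)
  import Relation.Binary.Reasoning.Setoid as SetoidReasoning
  open import Relation.Binary.PropositionalEquality using (_≡_; refl; sym; subst)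
  open Chebyshev

  infix 4 p∣_ _≈_

  p∣_ : ℤ → Set
  p∣ x = + p ∣ x

  record _≈_ (x y : ℤ) : Set where
    constructor mod
    field divides-difference : p∣ x - y
  open _≈_ public

  ∣-resp-≡ : ∀ {x y} → x ≡ y → p∣ x → p∣ y
  ∣-resp-≡ = subst p∣_

  ∣⇒≈0 : ∀ {x} → p∣ x → x ≈ 0ℤ
  ∣⇒≈0 {x} p∣x = mod (∣-resp-≡ (sym (ℤP.+-identityʳ x)) p∣x)

  ≈0⇒∣ : ∀ {x} → x ≈ 0ℤ → p∣ x
  ≈0⇒∣ {x} (mod p∣x) = ∣-resp-≡ (ℤP.+-identityʳ x) p∣x

  ≈-refl : ∀ {x} → x ≈ x
  ≈-refl {x} = mod (divides 0ℤ (ℤP.+-inverseʳ x))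

  ≈-reflexive : ∀ {x y} → x ≡ y → x ≈ y
  ≈-reflexive refl = ≈-refl

  ≈-sym : ∀ {x y} → x ≈ y → y ≈ x
  ≈-sym {x} {y} (mod p∣x-y) = mod (∣-resp-≡ (negate x y) (∣m⇒∣-m p∣x-y))
    where negate : ∀ x y → - (x - y) ≡ y - x
          negate = solve-∀

  ≈-trans : ∀ {x y z} → x ≈ y → y ≈ z → x ≈ z
  ≈-trans {x} {y} {z} (mod p∣x-y) (mod p∣y-z) = mod (∣-resp-≡ (telescope x y z) (∣m∣n⇒∣m+n p∣x-y p∣y-z))
    where telescope : ∀ x y z → (x - y) + (y - z) ≡ x - z
          telescope = solve-∀

  ≈-setoid : Setoid _ _
  ≈-setoid = record
    { Carrier = ℤ ; _≈_ = _≈_ ; isEquivalence = record { refl = ≈-refl ; sym = ≈-sym ; trans = ≈-trans } }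

  module ≈-Reasoning = SetoidReasoning ≈-setoid

  +-cong : ∀ {x x′ y y′} → x ≈ x′ → y ≈ y′ → x + y ≈ x′ + y′
  +-cong {x} {x′} {y} {y′} (mod d) (mod e) = mod (∣-resp-≡ (regroup x x′ y y′) (∣m∣n⇒∣m+n d e))
    where regroup : ∀ x x′ y y′ → (x - x′) + (y - y′) ≡ (x + y) - (x′ + y′)
          regroup = solve-∀

  neg-cong : ∀ {x x′} → x ≈ x′ → - x ≈ - x′
  neg-cong {x} {x′} (mod d) = mod (∣-resp-≡ (regroup x x′) (∣m⇒∣-m d))
    where regroup : ∀ x x′ → - (x - x′) ≡ (- x) - (- x′)
          regroup = solve-∀

  -‿cong : ∀ {x x′ y y′} → x ≈ x′ → y ≈ y′ → x - y ≈ x′ - y′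
  -‿cong x≈x′ y≈y′ = +-cong x≈x′ (neg-cong y≈y′)

  *-cong : ∀ {x x′ y y′} → x ≈ x′ → y ≈ y′ → x * y ≈ x′ * y′
  *-cong {x} {x′} {y} {y′} (mod d) (mod e) = mod (∣-resp-≡ (regroup x x′ y y′) (∣m∣n⇒∣m+n (∣n⇒∣m*n y d) (∣n⇒∣m*n x′ e)))
    where regroup : ∀ x x′ y y′ → y * (x - x′) + x′ * (y - y′) ≡ x * y - x′ * y′
          regroup = solve-∀

  ^-cong : ∀ {x y} k → x ≈ y → x ^ k ≈ y ^ k
  ^-cong zero x≈y = ≈-refl
  ^-cong (suc k) x≈y = *-cong x≈y (^-cong k x≈y)

  +-cancelʳ-≈ : ∀ z {x y} → x + z ≈ y + z → x ≈ y
  +-cancelʳ-≈ z {x} {y} (mod d) = mod (∣-resp-≡ (regroup x y z) d)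
    where regroup : ∀ x y z → (x + z) - (y + z) ≡ x - y
          regroup = solve-∀

  Uℤ-congʳ : ∀ n {x y} → x ≈ y → Uℤ n x ≈ Uℤ n y
  Uℤ-congʳ zero x≈y = ≈-refl
  Uℤ-congʳ (suc zero) x≈y = ≈-refl
  Uℤ-congʳ (suc (suc n)) x≈y = -‿cong (*-cong x≈y (Uℤ-congʳ (suc n) x≈y)) (Uℤ-congʳ n x≈y)

  Cℤ-congʳ : ∀ n {x y} → x ≈ y → Cℤ n x ≈ Cℤ n y
  Cℤ-congʳ zero x≈y = ≈-refl
  Cℤ-congʳ (suc n) x≈y = -‿cong (Uℤ-congʳ (suc (suc n)) x≈y) (Uℤ-congʳ n x≈y)

module PrimeCongruence {p : ℕ} (prime : Prime p) where

  open import Data.Nat using (_<_)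
  import Data.Nat.Properties as ℕP
  import Data.Nat.Divisibility as ℕD
  open import Data.Nat.Primality using (euclidsLemma)
  open import Data.Integer using (ℤ; +_; _*_; _-_; 0ℤ)
  import Data.Integer.Properties as ℤP
  open import Data.Integer.Divisibility.Signed using (_∣_; ∣⇒∣ᵤ; ∣ᵤ⇒∣)
  open import Data.Integer.Tactic.RingSolver using (solve-∀)
  open import Data.Sum using (_⊎_; inj₁; inj₂; [_,_]′)
  open import Data.Empty using (⊥-elim)
  open import Relation.Nullary using (¬_)
  open import Relation.Binary.PropositionalEquality using (_≡_; subst)
  open Congruence p

  ∣*⇒∣⊎∣ : ∀ x y → p∣ x * y → p∣ x ⊎ p∣ y
  ∣*⇒∣⊎∣ x y p∣xy with euclidsLemma ℤ.∣ x ∣ ℤ.∣ y ∣ prime (subst (p ℕD.∣_) (ℤP.abs-* x y) (∣⇒∣ᵤ p∣xy))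
  ... | inj₁ p∣x = inj₁ (∣ᵤ⇒∣ p∣x)
  ... | inj₂ p∣y = inj₂ (∣ᵤ⇒∣ p∣y)

  ∤*∤⇒∤* : ∀ {x y} → ¬ p∣ x → ¬ p∣ y → ¬ p∣ x * y
  ∤*∤⇒∤* {x} {y} p∤x p∤y p∣xy = [ p∤x , p∤y ]′ (∣*⇒∣⊎∣ x y p∣xy)

  *-cancelˡ-≈ : ∀ c {x y} → ¬ p∣ c → c * x ≈ c * y → x ≈ y
  *-cancelˡ-≈ c {x} {y} p∤c (mod p∣cx-cy) with ∣*⇒∣⊎∣ c (x - y) (∣-resp-≡ (factor c x y) p∣cx-cy)
    where factor : ∀ c x y → c * x - c * y ≡ c * (x - y)
          factor = solve-∀
  ... | inj₁ p∣c = ⊥-elim (p∤c p∣c)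
  ... | inj₂ p∣x-y = mod p∣x-y

  *≈0⇒≈0⊎≈0 : ∀ x y → x * y ≈ 0ℤ → x ≈ 0ℤ ⊎ y ≈ 0ℤ
  *≈0⇒≈0⊎≈0 x y xy≈0 with ∣*⇒∣⊎∣ x y (≈0⇒∣ xy≈0)
  ... | inj₁ p∣x = inj₁ (∣⇒≈0 p∣x)
  ... | inj₂ p∣y = inj₂ (∣⇒≈0 p∣y)

  ∤-small : ∀ {k} → 0 < k → k < p → ¬ p∣ + k
  ∤-small {k} 0<k k<p p∣k = ℕP.<⇒≱ k<p (ℕD.∣⇒≤ {{ℕ.>-nonZero 0<k}} (∣⇒∣ᵤ p∣k))

module RootBound {p : ℕ} (prime : Prime p) where

  open import Data.Integer using (ℤ; _+_; _*_; _-_; 0ℤ)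
  open import Data.Integer.Tactic.RingSolver using (solve-∀)
  open import Data.List using (List; []; _∷_; length)
  open import Data.List.Relation.Unary.All using (All; []; _∷_; zipWith)
  open import Data.List.Relation.Unary.AllPairs using (AllPairs; []; _∷_)
  open import Data.Product using (_,_)
  open import Data.Sum using ([_,_]′)
  open import Data.Empty using (⊥-elim)
  open import Relation.Nullary using (¬_)
  open import Relation.Binary.PropositionalEquality using (_≡_; refl; sym; cong; subst)
  import Data.Nat.Properties as ℕP
  import Data.Integer.Properties as ℤP
  open Congruence p
  open PrimeCongruence prime

  eval : List ℤ → ℤ → ℤ
  eval [] t = 0ℤ
  eval (c ∷ cs) t = c + t * eval cs t

  divideByRoot : ℤ → List ℤ → List ℤ
  divideByRoot r [] = []
  divideByRoot r (c ∷ []) = []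
  divideByRoot r (c ∷ cs@(_ ∷ _)) = eval cs r ∷ divideByRoot r cs

  length-divideByRoot : ∀ r f → length (divideByRoot r f) ≡ ℕ.pred (length f)
  length-divideByRoot r [] = refl
  length-divideByRoot r (c ∷ []) = refl
  length-divideByRoot r (c ∷ cs@(_ ∷ _)) = cong suc (length-divideByRoot r cs)

  eval-divideByRoot : ∀ r f t → eval f t ≡ eval f r + (t - r) * eval (divideByRoot r f) t
  eval-divideByRoot r [] t = expand r t
    where expand : ∀ r t → 0ℤ ≡ 0ℤ + (t - r) * 0ℤ
          expand = solve-∀
  eval-divideByRoot r (c ∷ []) t = expand c r t
    where expand : ∀ c r t → c + t * 0ℤ ≡ c + r * 0ℤ + (t - r) * 0ℤ
          expand = solve-∀
  eval-divideByRoot r (c ∷ cs@(_ ∷ _)) t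
    rewrite eval-divideByRoot r cs t = expand c t r (eval cs r) (eval (divideByRoot r cs) t)
    where expand : ∀ c t r e q → c + t * (e + (t - r) * q) ≡ c + r * e + (t - r) * (e + t * q)
          expand = solve-∀

  Root : List ℤ → ℤ → Set
  Root f r = eval f r ≈ 0ℤ

  root-divideByRoot : ∀ f {r s} → Root f r → Root f s → ¬ r ≈ s → Root (divideByRoot r f) s
  root-divideByRoot f {r} {s} fr≈0 fs≈0 r≉s =
    [ (λ s-r≈0 → ⊥-elim (r≉s (≈-sym (mod (≈0⇒∣ s-r≈0))))) , (λ q≈0 → q≈0) ]′
      (*≈0⇒≈0⊎≈0 (s - r) q (≈-sym 0≈[s-r]q))
    where
    open ≈-Reasoning
    q = eval (divideByRoot r f) s
    0≈[s-r]q : 0ℤ ≈ (s - r) * q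
    0≈[s-r]q = begin
      0ℤ                      ≈⟨ ≈-sym fs≈0 ⟩
      eval f s                ≡⟨ eval-divideByRoot r f s ⟩
      eval f r + (s - r) * q  ≈⟨ +-cong fr≈0 (≈-refl {(s - r) * q}) ⟩
      0ℤ + (s - r) * q        ≡⟨ ℤP.+-identityˡ ((s - r) * q) ⟩
      (s - r) * q             ∎

  roots-bound : ∀ rs f → AllPairs (λ r s → ¬ r ≈ s) rs → All (Root f) rs → length f ℕ.≤ length rs →
                ∀ t → Root f t
  roots-bound [] [] [] [] _ t = ≈-refl
  roots-bound (r ∷ rs) f (r≉rs ∷ distinct) (fr≈0 ∷ frs≈0) length≤ t = begin
    eval f t                      ≡⟨ eval-divideByRoot r f t ⟩
    eval f r + (t - r) * q        ≈⟨ +-cong fr≈0 (*-cong (≈-refl {t - r}) q≈0) ⟩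
    0ℤ + (t - r) * 0ℤ             ≡⟨ cancel (t - r) ⟩
    0ℤ                            ∎
    where
    open ≈-Reasoning
    q = eval (divideByRoot r f) t
    cancel : ∀ x → 0ℤ + x * 0ℤ ≡ 0ℤ
    cancel = solve-∀
    q≈0 : q ≈ 0ℤ
    q≈0 = roots-bound rs (divideByRoot r f) distinct
      (zipWith (λ (r≉s , fs≈0) → root-divideByRoot f fr≈0 fs≈0 r≉s) (r≉rs , frs≈0))
      (subst (ℕ._≤ length rs) (sym (length-divideByRoot r f)) (ℕP.pred-mono-≤ length≤))
      t

module OddPrimeModulus (m : ℕ) (prime : Prime (suc (m ℕ.+ m))) where

  open import Data.Nat using (_<_; _≤_; _∸_; z≤n; s≤s)
  import Data.Nat.Properties as ℕP
  open import Data.Integer using (ℤ; +_; -[1+_]; _+_; _*_; _-_; -_; 0ℤ; 1ℤ; _^_; _%ℕ_; _/ℕ_)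
  import Data.Integer.Properties as ℤP
  open import Data.Integer.DivMod using (a≡a%ℕn+[a/ℕn]*n)
  open import Data.Integer.Divisibility.Signed using (divides; ∣m⇒∣-m)
  open import Data.Integer.Tactic.RingSolver using (solve-∀)
  open import Data.List using (List; []; _∷_; length; applyUpTo)
  open import Data.List.Properties using (length-applyUpTo)
  open import Data.List.Relation.Unary.All as All using (All; []; _∷_)
  import Data.List.Relation.Unary.All.Properties as All
  open import Data.List.Relation.Unary.AllPairs using (AllPairs; []; _∷_)
  import Data.List.Relation.Unary.AllPairs.Properties as AllPairs
  open import Data.Product using (∃-syntax; _,_; proj₁; proj₂)
  open import Data.Sum using ([_,_]′)
  open import Data.Empty using (⊥-elim)
  open import Relation.Nullary using (¬_)
  open import Relation.Binary.PropositionalEquality using (_≡_; refl; sym; trans; cong; cong₂; subst; module ≡-Reasoning)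
  open import Algebra.Bundles using (CommutativeSemiring)
  open BinomialFrobenius using (prime>1; freshmans-dream)

  p : ℕ
  p = suc (m ℕ.+ m)

  open Congruence p public
  open PrimeCongruence prime public

  m≡1+pred[m] : m ≡ suc (ℕ.pred m)
  m≡1+pred[m] = positive m (prime>1 prime)
    where positive : ∀ n → 1 < suc (n ℕ.+ n) → n ≡ suc (ℕ.pred n)
          positive zero (s≤s ())
          positive (suc n) _ = refl

  ∤1 : ¬ p∣ 1ℤ
  ∤1 = ∤-small (s≤s z≤n) (prime>1 prime)

  ∤2 : ¬ p∣ + 2
  ∤2 = ∤-small (s≤s z≤n) (s≤s (ℕP.+-mono-≤ 1≤m 1≤m))
    where 1≤m = subst (1 ≤_) (sym m≡1+pred[m]) (s≤s z≤n)

  ≈-remainder : ∀ u → u ≈ + (u %ℕ p)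
  ≈-remainder u = ≈-sym (mod (divides (- (u /ℕ p)) (difference (+ (u %ℕ p)) (u /ℕ p) (+ p) u (a≡a%ℕn+[a/ℕn]*n u p))))
    where
    difference : ∀ r q d u → u ≡ r + q * d → r - u ≡ (- q) * d
    difference r q d _ refl = expand r q d
      where expand : ∀ r q d → r - (r + q * d) ≡ (- q) * d
            expand = solve-∀

  module ℤ-semiring = CommutativeSemiring ℤP.+-*-commutativeSemiring
  open import Algebra.Properties.Semiring.Exp ℤ-semiring.semiring using () renaming (_^_ to _^ˢ_)
  open import Algebra.Properties.Monoid.Mult ℤ-semiring.+-monoid using (_×_)

  ^ˢ≡^ : ∀ x k → x ^ˢ k ≡ x ^ k
  ^ˢ≡^ x zero = refl
  ^ˢ≡^ x (suc k) = cong (x *_) (^ˢ≡^ x k)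

  ×1≡+ : ∀ k → k × 1ℤ ≡ + k
  ×1≡+ zero = refl
  ×1≡+ (suc k) = trans (cong (_+_ 1ℤ) (×1≡+ k)) (sym (ℤP.pos-+ 1 k))

  frobenius : ∀ x y → (x + y) ^ p ≈ x ^ p + y ^ p
  frobenius x y with freshmans-dream ℤP.+-*-commutativeSemiring prime x y
  ... | w , expansion = begin
    (x + y) ^ p                         ≡⟨ sym (^ˢ≡^ (x + y) p) ⟩
    (x + y) ^ˢ p                        ≡⟨ expansion ⟩
    (x ^ˢ p + y ^ˢ p) + (p × 1ℤ) * w    ≡⟨ cong₂ (λ a b → (a + y ^ˢ p) + b * w) (^ˢ≡^ x p) (×1≡+ p) ⟩
    (x ^ p + y ^ˢ p) + + p * w          ≡⟨ cong (λ a → (x ^ p + a) + + p * w) (^ˢ≡^ y p) ⟩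
    (x ^ p + y ^ p) + + p * w           ≈⟨ +-cong (≈-refl {x ^ p + y ^ p}) (∣⇒≈0 (divides w (ℤP.*-comm (+ p) w))) ⟩
    (x ^ p + y ^ p) + 0ℤ                ≡⟨ ℤP.+-identityʳ _ ⟩
    x ^ p + y ^ p                       ∎
    where open ≈-Reasoning

  fermat-ℕ : ∀ j → (+ j) ^ p ≈ + j
  fermat-ℕ zero = ≈-refl
  fermat-ℕ (suc j) = begin
    (1ℤ + + j) ^ p    ≈⟨ frobenius 1ℤ (+ j) ⟩
    1ℤ ^ p + (+ j) ^ p  ≈⟨ +-cong (≈-reflexive (ℤP.^-zeroˡ p)) (fermat-ℕ j) ⟩
    1ℤ + + j          ∎
    where open ≈-Reasoning

  fermat : ∀ u → u ^ p ≈ u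
  fermat u = begin
    u ^ p               ≈⟨ ^-cong p (≈-remainder u) ⟩
    (+ (u %ℕ p)) ^ p      ≈⟨ fermat-ℕ (u %ℕ p) ⟩
    + (u %ℕ p)          ≈⟨ ≈-sym (≈-remainder u) ⟩
    u                   ∎
    where open ≈-Reasoning

  fermat-unit : ∀ {u} → ¬ p∣ u → u ^ (m ℕ.+ m) ≈ 1ℤ
  fermat-unit {u} p∤u = *-cancelˡ-≈ u p∤u (≈-trans (fermat u) (≈-reflexive (sym (ℤP.*-identityʳ u))))

  inverse : ∀ {u} → ¬ p∣ u → ∃[ w ] u * w ≈ 1ℤ
  inverse {u} p∤u =
    u ^ (ℕ.pred m ℕ.+ m) , ≈-trans (≈-reflexive (cong (λ k → u ^ (k ℕ.+ m)) (sym m≡1+pred[m]))) (fermat-unit p∤u)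

  ^-distribʳ-* : ∀ x y k → (x * y) ^ k ≡ x ^ k * y ^ k
  ^-distribʳ-* x y zero = refl
  ^-distribʳ-* x y (suc k) = trans (cong ((x * y) *_) (^-distribʳ-* x y k)) (interchange x y (x ^ k) (y ^ k))
    where interchange : ∀ x y u v → x * y * (u * v) ≡ x * u * (y * v)
          interchange = solve-∀

  ^-square : ∀ y k → (y * y) ^ k ≡ y ^ (k ℕ.+ k)
  ^-square y k = trans (^-distribʳ-* y y k) (sym (ℤP.^-distribˡ-+-* y k k))

  euler-square : ∀ {c} y → ¬ p∣ c → y * y ≈ c → c ^ m ≈ 1ℤ
  euler-square {c} y p∤c y²≈c = begin
    c ^ m             ≈⟨ ^-cong m (≈-sym y²≈c) ⟩
    (y * y) ^ m       ≡⟨ ^-square y m ⟩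
    y ^ (m ℕ.+ m)     ≈⟨ fermat-unit p∤y ⟩
    1ℤ                ∎
    where
    open ≈-Reasoning
    p∤y : ¬ p∣ y
    p∤y p∣y = p∤c (≈0⇒∣ (≈-trans (≈-sym y²≈c) (*-cong (∣⇒≈0 p∣y) (≈-refl {y}))))

  open RootBound prime using (eval; Root; roots-bound)

  m<p : m < p
  m<p = s≤s (ℕP.m≤m+n m m)

  squares-distinct : ∀ {a b} → 0 < a → a < b → b ≤ m → ¬ (+ a) * (+ a) ≈ (+ b) * (+ b)
  squares-distinct {a} {b} 0<a a<b b≤m (mod p∣a²-b²) =
    [ ∤-small 0<d d<p , ∤-small 0<a+b a+b<p ]′ (∣*⇒∣⊎∣ (+ d) (+ (a ℕ.+ b)) (∣-resp-≡ factor (∣m⇒∣-m p∣a²-b²)))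
    where
    open ≡-Reasoning
    d = b ∸ a
    0<d = ℕP.m<n⇒0<n∸m a<b
    d<p = ℕP.≤-<-trans (ℕP.m∸n≤m b a) (ℕP.≤-<-trans b≤m m<p)
    0<a+b = ℕP.<-≤-trans 0<a (ℕP.m≤m+n a b)
    a+b<p = s≤s (ℕP.+-mono-≤ (ℕP.<⇒≤ (ℕP.<-≤-trans a<b b≤m)) b≤m)
    b≡a+d : + b ≡ + a + + d
    b≡a+d = trans (cong +_ (sym (ℕP.m+[n∸m]≡n (ℕP.<⇒≤ a<b)))) (ℤP.pos-+ a d)
    expand : ∀ A D → - (A * A - (A + D) * (A + D)) ≡ D * (A + (A + D))
    expand = solve-∀
    factor : - ((+ a) * (+ a) - (+ b) * (+ b)) ≡ + d * + (a ℕ.+ b)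
    factor = begin
      - ((+ a) * (+ a) - (+ b) * (+ b))              ≡⟨ cong (λ B → - ((+ a) * (+ a) - B * B)) b≡a+d ⟩
      - ((+ a) * (+ a) - (+ a + + d) * (+ a + + d))  ≡⟨ expand (+ a) (+ d) ⟩
      + d * (+ a + (+ a + + d))                      ≡⟨ cong (λ B → + d * (+ a + B)) (sym b≡a+d) ⟩
      + d * (+ a + + b)                              ≡⟨ cong (+ d *_) (sym (ℤP.pos-+ a b)) ⟩
      + d * + (a ℕ.+ b)                              ∎

  monomial : ℕ → List ℤ
  monomial zero = 1ℤ ∷ []
  monomial (suc k) = 0ℤ ∷ monomial k

  eval-monomial : ∀ k t → eval (monomial k) t ≡ t ^ k
  eval-monomial zero t = cong (_+_ 1ℤ) (ℤP.*-zeroʳ t)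
  eval-monomial (suc k) t = trans (ℤP.+-identityˡ (t * eval (monomial k) t)) (cong (t *_) (eval-monomial k t))

  length-monomial : ∀ k → length (monomial k) ≡ suc k
  length-monomial zero = refl
  length-monomial (suc k) = cong suc (length-monomial k)

  xᵐ-1 : List ℤ
  xᵐ-1 = - 1ℤ ∷ monomial (ℕ.pred m)

  eval-xᵐ-1 : ∀ t → eval xᵐ-1 t ≡ - 1ℤ + t ^ m
  eval-xᵐ-1 t = cong (_+_ (- 1ℤ)) (trans (cong (t *_) (eval-monomial (ℕ.pred m) t))
                                         (cong (t ^_) (sym m≡1+pred[m])))

  root-xᵐ-1 : ∀ {t} → t ^ m ≈ 1ℤ → Root xᵐ-1 t
  root-xᵐ-1 {t} tᵐ≈1 = ≈-trans (≈-reflexive (eval-xᵐ-1 t)) (+-cong (≈-refl { - 1ℤ}) tᵐ≈1)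

  squares : List ℤ
  squares = applyUpTo (λ i → + suc i * + suc i) m

  -- Otherwise xᵐ − 1 would have the m + 1 distinct roots c, 1², …, m².
  nonsquare⇒ᵐ≉1 : ∀ {c} → (∀ y → ¬ y * y ≈ c) → ¬ c ^ m ≈ 1ℤ
  nonsquare⇒ᵐ≉1 {c} nonsquare cᵐ≈1 = ∤1 (∣-resp-≡ (ℤP.neg-involutive 1ℤ) (∣m⇒∣-m (≈0⇒∣ -1≈0)))
    where
    open ≈-Reasoning
    p∤1+i : ∀ {i} → i < m → ¬ p∣ + suc i
    p∤1+i i<m = ∤-small (s≤s z≤n) (ℕP.≤-<-trans i<m m<p)
    distinct : AllPairs (λ r s → ¬ r ≈ s) (c ∷ squares)
    distinct = All.applyUpTo⁺₂ _ m (λ i c≈i² → nonsquare (+ suc i) (≈-sym c≈i²))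
             ∷ AllPairs.applyUpTo⁺₁ _ m (λ i<j j<m → squares-distinct (s≤s z≤n) (s≤s i<j) j<m)
    roots-of-squares : All (Root xᵐ-1) squares
    roots-of-squares = All.applyUpTo⁺₁ _ m (λ {i} i<m →
      root-xᵐ-1 (euler-square (+ suc i) (∤*∤⇒∤* (p∤1+i i<m) (p∤1+i i<m)) ≈-refl))
    length≤ : length xᵐ-1 ℕ.≤ length (c ∷ squares)
    length≤ = ℕP.≤-reflexive (cong suc (trans (trans (length-monomial (ℕ.pred m)) (sym m≡1+pred[m]))
                                              (sym (length-applyUpTo _ m))))
    -1≈0 : - 1ℤ ≈ 0ℤ
    -1≈0 = begin
      - 1ℤ            ≡⟨ sym (trans (eval-xᵐ-1 0ℤ) (cong (_+_ (- 1ℤ)) (cong (0ℤ ^_) m≡1+pred[m]))) ⟩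
      eval xᵐ-1 0ℤ    ≈⟨ roots-bound (c ∷ squares) xᵐ-1 distinct (root-xᵐ-1 cᵐ≈1 ∷ roots-of-squares) length≤ 0ℤ ⟩
      0ℤ              ∎

  euler-nonsquare : ∀ {c} → (∀ y → ¬ y * y ≈ c) → c ^ m ≈ - 1ℤ
  euler-nonsquare {c} nonsquare =
    [ (λ cᵐ-1≈0 → ⊥-elim (nonsquare⇒ᵐ≉1 nonsquare (mod (≈0⇒∣ cᵐ-1≈0)))) , (λ cᵐ+1≈0 → mod (≈0⇒∣ cᵐ+1≈0)) ]′
      (*≈0⇒≈0⊎≈0 (c ^ m - 1ℤ) (c ^ m + 1ℤ) product≈0)
    where
    open ≈-Reasoning
    p∤c : ¬ p∣ c
    p∤c p∣c = nonsquare 0ℤ (≈-sym (∣⇒≈0 p∣c))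
    difference-of-squares : ∀ x → (x - 1ℤ) * (x + 1ℤ) ≡ x * x - 1ℤ
    difference-of-squares = solve-∀
    product≈0 : (c ^ m - 1ℤ) * (c ^ m + 1ℤ) ≈ 0ℤ
    product≈0 = begin
      (c ^ m - 1ℤ) * (c ^ m + 1ℤ)   ≡⟨ difference-of-squares (c ^ m) ⟩
      c ^ m * c ^ m - 1ℤ            ≡⟨ cong (_- 1ℤ) (sym (ℤP.^-distribˡ-+-* c m m)) ⟩
      c ^ (m ℕ.+ m) - 1ℤ            ≈⟨ -‿cong (fermat-unit p∤c) (≈-refl {1ℤ}) ⟩
      1ℤ - 1ℤ                       ≡⟨⟩
      0ℤ                            ∎

  square-*-unit² : ∀ {c u} → ¬ p∣ u → ∃[ y ] y * y ≈ c * (u * u) → ∃[ y ] y * y ≈ c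
  square-*-unit² {c} {u} p∤u (y , y²≈cu²) = y * w , (begin
    (y * w) * (y * w)           ≡⟨ regroup y w ⟩
    (y * y) * (w * w)           ≈⟨ *-cong y²≈cu² (≈-refl {w * w}) ⟩
    c * (u * u) * (w * w)       ≡⟨ regroup′ c u w ⟩
    c * ((u * w) * (u * w))     ≈⟨ *-cong (≈-refl {c}) (*-cong uw≈1 uw≈1) ⟩
    c * (1ℤ * 1ℤ)               ≡⟨ ℤP.*-identityʳ c ⟩
    c                           ∎)
    where
    open ≈-Reasoning
    w = proj₁ (inverse p∤u)
    uw≈1 = proj₂ (inverse p∤u)
    regroup : ∀ y w → (y * w) * (y * w) ≡ (y * y) * (w * w)
    regroup = solve-∀
    regroup′ : ∀ c u w → c * (u * u) * (w * w) ≡ c * ((u * w) * (u * w))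
    regroup′ = solve-∀

  square⇒square-*-unit² : ∀ {c} u → ∃[ y ] y * y ≈ c → ∃[ y ] y * y ≈ c * (u * u)
  square⇒square-*-unit² {c} u (y , y²≈c) = y * u , (begin
    (y * u) * (y * u)           ≡⟨ regroup y u ⟩
    (y * y) * (u * u)           ≈⟨ *-cong y²≈c (≈-refl {u * u}) ⟩
    c * (u * u)                 ∎)
    where
    open ≈-Reasoning
    regroup : ∀ y u → (y * u) * (y * u) ≡ (y * y) * (u * u)
    regroup = solve-∀

module QuadraticExtension (a : ℤ) where

  open import Data.Integer using (+_; _+_; _*_; _-_; -_; 0ℤ; 1ℤ)
  import Data.Integer.Properties as ℤP
  open import Data.Integer.Tactic.RingSolver using (solve-∀)
  open import Data.Product using (_×_; _,_)
  open import Relation.Binary.PropositionalEquality using (_≡_; refl; sym; trans; cong; cong₂; isEquivalence)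
  open import Algebra.Bundles using (CommutativeSemiring)
  open import Algebra.Structures {A = ℤ × ℤ} _≡_ using (IsCommutativeMonoid)
  open import Algebra.Structures.Biased {A = ℤ × ℤ} _≡_ using (IsCommutativeSemiringˡ)
  open Chebyshev

  -- (u , v) stands for u + vX, with X² = aX − 1; X̄ = a − X is the inverse of X.
  infixl 6 _⊕_
  infixl 7 _⊗_

  _⊕_ : ℤ × ℤ → ℤ × ℤ → ℤ × ℤ
  (u , v) ⊕ (u′ , v′) = (u + u′ , v + v′)

  _⊗_ : ℤ × ℤ → ℤ × ℤ → ℤ × ℤ
  (u , v) ⊗ (u′ , v′) = (u * u′ - v * v′ , u * v′ + v * u′ + a * (v * v′))

  𝟘 𝟙 X X̄ : ℤ × ℤ
  𝟘 = (0ℤ , 0ℤ)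
  𝟙 = (1ℤ , 0ℤ)
  X = (0ℤ , 1ℤ)
  X̄ = (a , - 1ℤ)

  ι : ℤ → ℤ × ℤ
  ι u = (u , 0ℤ)

  ⊕-comm : ∀ x y → x ⊕ y ≡ y ⊕ x
  ⊕-comm (u , v) (u′ , v′) = cong₂ _,_ (comm u u′) (comm v v′)
    where comm : ∀ u u′ → u + u′ ≡ u′ + u
          comm = solve-∀
  ⊕-assoc : ∀ x y z → (x ⊕ y) ⊕ z ≡ x ⊕ (y ⊕ z)
  ⊕-assoc (u , v) (u′ , v′) (u″ , v″) = cong₂ _,_ (assoc u u′ u″) (assoc v v′ v″)
    where assoc : ∀ u u′ u″ → (u + u′) + u″ ≡ u + (u′ + u″)
          assoc = solve-∀
  ⊕-identityˡ : ∀ x → 𝟘 ⊕ x ≡ x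
  ⊕-identityˡ (u , v) = cong₂ _,_ (identity u) (identity v)
    where identity : ∀ u → 0ℤ + u ≡ u
          identity = solve-∀
  ⊕-identityʳ : ∀ x → x ⊕ 𝟘 ≡ x
  ⊕-identityʳ x = trans (⊕-comm x 𝟘) (⊕-identityˡ x)
  ⊗-comm : ∀ x y → x ⊗ y ≡ y ⊗ x
  ⊗-comm (u , v) (u′ , v′) = cong₂ _,_ (comm₁ u v u′ v′) (comm₂ a u v u′ v′)
    where comm₁ : ∀ u v u′ v′ → u * u′ - v * v′ ≡ u′ * u - v′ * v
          comm₁ = solve-∀
          comm₂ : ∀ a u v u′ v′ → u * v′ + v * u′ + a * (v * v′) ≡ u′ * v + v′ * u + a * (v′ * v)
          comm₂ = solve-∀
  ⊗-assoc : ∀ x y z → (x ⊗ y) ⊗ z ≡ x ⊗ (y ⊗ z)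
  ⊗-assoc (u , v) (u′ , v′) (u″ , v″) = cong₂ _,_ (assoc₁ a u v u′ v′ u″ v″) (assoc₂ a u v u′ v′ u″ v″)
    where assoc₁ : ∀ a u v u′ v′ u″ v″ →
                   (u * u′ - v * v′) * u″ - (u * v′ + v * u′ + a * (v * v′)) * v″
                   ≡ u * (u′ * u″ - v′ * v″) - v * (u′ * v″ + v′ * u″ + a * (v′ * v″))
          assoc₁ = solve-∀
          assoc₂ : ∀ a u v u′ v′ u″ v″ →
                   (u * u′ - v * v′) * v″ + (u * v′ + v * u′ + a * (v * v′)) * u″ + a * ((u * v′ + v * u′ + a * (v * v′)) * v″)
                   ≡ u * (u′ * v″ + v′ * u″ + a * (v′ * v″)) + v * (u′ * u″ - v′ * v″) + a * (v * (u′ * v″ + v′ * u″ + a * (v′ * v″)))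
          assoc₂ = solve-∀
  ⊗-identityˡ : ∀ x → 𝟙 ⊗ x ≡ x
  ⊗-identityˡ (u , v) = cong₂ _,_ (identity₁ u v) (identity₂ a u v)
    where identity₁ : ∀ u v → 1ℤ * u - 0ℤ * v ≡ u
          identity₁ = solve-∀
          identity₂ : ∀ a u v → 1ℤ * v + 0ℤ * u + a * (0ℤ * v) ≡ v
          identity₂ = solve-∀
  ⊗-identityʳ : ∀ x → x ⊗ 𝟙 ≡ x
  ⊗-identityʳ x = trans (⊗-comm x 𝟙) (⊗-identityˡ x)
  ⊗-distribʳ-⊕ : ∀ x y z → (y ⊕ z) ⊗ x ≡ (y ⊗ x) ⊕ (z ⊗ x)
  ⊗-distribʳ-⊕ (u , v) (u′ , v′) (u″ , v″) = cong₂ _,_ (distrib₁ u v u′ v′ u″ v″) (distrib₂ a u v u′ v′ u″ v″)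
    where distrib₁ : ∀ u v u′ v′ u″ v″ → (u′ + u″) * u - (v′ + v″) * v ≡ (u′ * u - v′ * v) + (u″ * u - v″ * v)
          distrib₁ = solve-∀
          distrib₂ : ∀ a u v u′ v′ u″ v″ → (u′ + u″) * v + (v′ + v″) * u + a * ((v′ + v″) * v)
                                           ≡ (u′ * v + v′ * u + a * (v′ * v)) + (u″ * v + v″ * u + a * (v″ * v))
          distrib₂ = solve-∀
  ⊗-zeroˡ : ∀ x → 𝟘 ⊗ x ≡ 𝟘
  ⊗-zeroˡ (u , v) = cong₂ _,_ (zero₁ u v) (zero₂ a u v)
    where zero₁ : ∀ u v → 0ℤ * u - 0ℤ * v ≡ 0ℤ
          zero₁ = solve-∀
          zero₂ : ∀ a u v → 0ℤ * v + 0ℤ * u + a * (0ℤ * v) ≡ 0ℤ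
          zero₂ = solve-∀

  isCommutativeMonoid : ∀ {_∙_ e} → (∀ x y z → (x ∙ y) ∙ z ≡ x ∙ (y ∙ z)) → (∀ x y → x ∙ y ≡ y ∙ x) →
                        (∀ x → e ∙ x ≡ x) → (∀ x → x ∙ e ≡ x) → IsCommutativeMonoid _∙_ e
  isCommutativeMonoid {_∙_} assoc comm identityˡ identityʳ = record
    { isMonoid = record
      { isSemigroup = record
        { isMagma = record { isEquivalence = isEquivalence ; ∙-cong = cong₂ _∙_ }
        ; assoc = assoc }
      ; identity = identityˡ , identityʳ }
    ; comm = comm }

  ring : CommutativeSemiring _ _
  ring = record
    { Carrier = ℤ × ℤ ; _≈_ = _≡_ ; _+_ = _⊕_ ; _*_ = _⊗_ ; 0# = 𝟘 ; 1# = 𝟙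
    ; isCommutativeSemiring = IsCommutativeSemiringˡ.isCommutativeSemiring (record
       { +-isCommutativeMonoid = isCommutativeMonoid ⊕-assoc ⊕-comm ⊕-identityˡ ⊕-identityʳ
       ; *-isCommutativeMonoid = isCommutativeMonoid ⊗-assoc ⊗-comm ⊗-identityˡ ⊗-identityʳ
       ; distribʳ = ⊗-distribʳ-⊕
       ; zeroˡ = ⊗-zeroˡ }) }

  open CommutativeSemiring ring public using () renaming (distribˡ to ⊗-distribˡ-⊕; zeroʳ to ⊗-zeroʳ)
  open import Algebra.Properties.Semiring.Exp (CommutativeSemiring.semiring ring) public using (_^_; ^-homo-*)
  open import Algebra.Properties.CommutativeSemiring.Exp ring public using (^-distrib-*)

  ι-⊗ : ∀ u w → ι u ⊗ ι w ≡ ι (u * w)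
  ι-⊗ u w = cong₂ _,_ (product₁ u w) (product₂ a u w)
    where product₁ : ∀ u w → u * w - 0ℤ * 0ℤ ≡ u * w
          product₁ = solve-∀
          product₂ : ∀ a u w → u * 0ℤ + 0ℤ * w + a * (0ℤ * 0ℤ) ≡ 0ℤ
          product₂ = solve-∀

  ι-^ : ∀ u n → ι u ^ n ≡ ι (u ℤ.^ n)
  ι-^ u zero = refl
  ι-^ u (suc n) = trans (cong (ι u ⊗_) (ι-^ u n)) (ι-⊗ u (u ℤ.^ n))

  ι⊗ : ∀ k u v → ι k ⊗ (u , v) ≡ (k * u , k * v)
  ι⊗ k u v = cong₂ _,_ (product₁ k u v) (product₂ a k u v)
    where product₁ : ∀ k u v → k * u - 0ℤ * v ≡ k * u
          product₁ = solve-∀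
          product₂ : ∀ a k u v → k * v + 0ℤ * u + a * (0ℤ * v) ≡ k * v
          product₂ = solve-∀

  X̄⊗X : X̄ ⊗ X ≡ 𝟙
  X̄⊗X = cong₂ _,_ (product₁ a) (product₂ a)
    where product₁ : ∀ a → a * 0ℤ - - 1ℤ * 1ℤ ≡ 1ℤ
          product₁ = solve-∀
          product₂ : ∀ a → a * 1ℤ + - 1ℤ * 0ℤ + a * (- 1ℤ * 1ℤ) ≡ 0ℤ
          product₂ = solve-∀

  X⊗X̄ : X ⊗ X̄ ≡ 𝟙
  X⊗X̄ = trans (⊗-comm X X̄) X̄⊗X

  𝟙^ : ∀ n → 𝟙 ^ n ≡ 𝟙
  𝟙^ n = trans (ι-^ 1ℤ n) (cong ι (ℤP.^-zeroˡ n))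

  X^n⊗X̄^n : ∀ n → X ^ n ⊗ X̄ ^ n ≡ 𝟙
  X^n⊗X̄^n n = trans (sym (^-distrib-* X X̄ n)) (trans (cong (_^ n) X⊗X̄) (𝟙^ n))

  X̄^n⊗[X^n⊗x] : ∀ n x → X̄ ^ n ⊗ (X ^ n ⊗ x) ≡ x
  X̄^n⊗[X^n⊗x] n x = trans (sym (⊗-assoc (X̄ ^ n) (X ^ n) x))
                         (trans (cong (_⊗ x) (trans (⊗-comm (X̄ ^ n) (X ^ n)) (X^n⊗X̄^n n))) (⊗-identityˡ x))

  X̄⊗X^[1+n] : ∀ n → X̄ ⊗ X ^ suc n ≡ X ^ n
  X̄⊗X^[1+n] n = trans (sym (⊗-assoc X̄ X (X ^ n))) (trans (cong (_⊗ X ^ n) X̄⊗X) (⊗-identityˡ (X ^ n)))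

  X̄⊗[k⊗X] : ∀ k → X̄ ⊗ (ι k ⊗ X) ≡ ι k
  X̄⊗[k⊗X] k = trans (cong (X̄ ⊗_) (⊗-comm (ι k) X))
                 (trans (sym (⊗-assoc X̄ X (ι k))) (trans (cong (_⊗ ι k) X̄⊗X) (⊗-identityˡ (ι k))))

  X^1+n : ∀ n → X ^ suc n ≡ (- Uℤ n a , Uℤ (suc n) a)
  X^1+n zero = cong₂ _,_ (power₁ a) (power₂ a)
    where power₁ : ∀ a → 0ℤ * 1ℤ - 1ℤ * 0ℤ ≡ - 0ℤ
          power₁ = solve-∀
          power₂ : ∀ a → 0ℤ * 0ℤ + 1ℤ * 1ℤ + a * (1ℤ * 0ℤ) ≡ 1ℤ
          power₂ = solve-∀
  X^1+n (suc n) = trans (cong (X ⊗_) (X^1+n n))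
                        (cong₂ _,_ (step₁ a (Uℤ (suc n) a) (Uℤ n a)) (step₂ a (Uℤ (suc n) a) (Uℤ n a)))
    where step₁ : ∀ a u₁ u₀ → 0ℤ * - u₀ - 1ℤ * u₁ ≡ - u₁
          step₁ = solve-∀
          step₂ : ∀ a u₁ u₀ → 0ℤ * u₁ + 1ℤ * - u₀ + a * (1ℤ * u₁) ≡ a * u₁ - u₀
          step₂ = solve-∀

  X̄^1+n : ∀ n → X̄ ^ suc n ≡ (Uℤ (suc (suc n)) a , - Uℤ (suc n) a)
  X̄^1+n zero = cong₂ _,_ (power₁ a) (power₂ a)
    where power₁ : ∀ a → a * 1ℤ - - 1ℤ * 0ℤ ≡ a * 1ℤ - 0ℤ
          power₁ = solve-∀
          power₂ : ∀ a → a * 0ℤ + - 1ℤ * 1ℤ + a * (- 1ℤ * 0ℤ) ≡ - 1ℤ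
          power₂ = solve-∀
  X̄^1+n (suc n) = trans (cong (X̄ ⊗_) (X̄^1+n n))
                        (cong₂ _,_ (step₁ a (Uℤ (suc n) a) (Uℤ n a)) (step₂ a (Uℤ (suc n) a) (Uℤ n a)))
    where step₁ : ∀ a u₁ u₀ → a * (a * u₁ - u₀) - - 1ℤ * - u₁ ≡ a * (a * u₁ - u₀) - u₁
          step₁ = solve-∀
          step₂ : ∀ a u₁ u₀ → a * - u₁ + - 1ℤ * (a * u₁ - u₀) + a * (- 1ℤ * - u₁) ≡ - (a * u₁ - u₀)
          step₂ = solve-∀

  X^+X̄^ : ∀ n → X ^ n ⊕ X̄ ^ n ≡ ι (Cℤ n a)
  X^+X̄^ zero = refl
  X^+X̄^ (suc n) = trans (cong₂ _⊕_ (X^1+n n) (X̄^1+n n))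
                        (cong₂ _,_ (sum₁ (Uℤ (suc (suc n)) a) (Uℤ n a)) (sum₂ (Uℤ (suc n) a)))
    where sum₁ : ∀ u₂ u₀ → - u₀ + u₂ ≡ u₂ - u₀
          sum₁ = solve-∀
          sum₂ : ∀ u₁ → u₁ + - u₁ ≡ 0ℤ
          sum₂ = solve-∀

  Y : ℤ × ℤ
  Y = X ⊕ 𝟙

  Y⊗Y : Y ⊗ Y ≡ ι (a + + 2) ⊗ X
  Y⊗Y = cong₂ _,_ (product₁ a) (product₂ a)
    where product₁ : ∀ a → 1ℤ * 1ℤ - 1ℤ * 1ℤ ≡ (a + + 2) * 0ℤ - 0ℤ * 1ℤ
          product₁ = solve-∀
          product₂ : ∀ a → 1ℤ * 1ℤ + 1ℤ * 1ℤ + a * (1ℤ * 1ℤ) ≡ (a + + 2) * 1ℤ + 0ℤ * 0ℤ + a * (0ℤ * 1ℤ)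
          product₂ = solve-∀

  Y⊗[X̄⊕𝟙] : Y ⊗ (X̄ ⊕ 𝟙) ≡ ι (a + + 2)
  Y⊗[X̄⊕𝟙] = cong₂ _,_ (product₁ a) (product₂ a)
    where product₁ : ∀ a → 1ℤ * (a + 1ℤ) - 1ℤ * (- 1ℤ + 0ℤ) ≡ a + + 2
          product₁ = solve-∀
          product₂ : ∀ a → 1ℤ * (- 1ℤ + 0ℤ) + 1ℤ * (a + 1ℤ) + a * (1ℤ * (- 1ℤ + 0ℤ)) ≡ 0ℤ
          product₂ = solve-∀

  √D : ℤ × ℤ
  √D = (- a , + 2)

  √D≡2X-a : √D ≡ ι (+ 2) ⊗ X ⊕ ι (- a)
  √D≡2X-a = cong₂ _,_ (expand₁ a) (expand₂ a)
    where expand₁ : ∀ a → - a ≡ + 2 * 0ℤ - 0ℤ * 1ℤ + - a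
          expand₁ = solve-∀
          expand₂ : ∀ a → + 2 ≡ + 2 * 1ℤ + 0ℤ * 0ℤ + a * (0ℤ * 1ℤ) + 0ℤ
          expand₂ = solve-∀

  √D⊗√D : √D ⊗ √D ≡ ι (a * a - + 4)
  √D⊗√D = cong₂ _,_ (square₁ a) (square₂ a)
    where square₁ : ∀ a → - a * - a - + 2 * + 2 ≡ a * a - + 4
          square₁ = solve-∀
          square₂ : ∀ a → - a * + 2 + + 2 * - a + a * (+ 2 * + 2) ≡ 0ℤ
          square₂ = solve-∀

  √D⊗ι[-1] : √D ⊗ ι (- 1ℤ) ≡ ι (+ 2) ⊗ X̄ ⊕ ι (- a)
  √D⊗ι[-1] = cong₂ _,_ (product₁ a) (product₂ a)
    where product₁ : ∀ a → - a * - 1ℤ - + 2 * 0ℤ ≡ + 2 * a - 0ℤ * - 1ℤ + - a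
          product₁ = solve-∀
          product₂ : ∀ a → - a * 0ℤ + + 2 * - 1ℤ + a * (+ 2 * 0ℤ) ≡ + 2 * - 1ℤ + 0ℤ * a + a * (0ℤ * - 1ℤ) + 0ℤ
          product₂ = solve-∀

module QuadraticExtensionModulo (m : ℕ) (prime : Prime (suc (m ℕ.+ m))) (a : ℤ) where

  open import Data.Integer using (+_; _+_; _*_; _-_; -_; 0ℤ; 1ℤ)
  import Data.Nat.Properties as ℕP
  import Data.Integer.Properties as ℤP
  open import Data.Integer.Divisibility.Signed using (divides; ∣m⇒∣-m)
  open import Data.Integer.Tactic.RingSolver using (solve-∀)
  open import Data.Product using (_×_; _,_; proj₁; proj₂)
  open import Relation.Nullary using (¬_)
  open import Relation.Binary.Bundles using (Setoid)
  open import Relation.Binary.PropositionalEquality using (_≡_; refl; sym; trans; cong; module ≡-Reasoning)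
  import Relation.Binary.Reasoning.Setoid as SetoidReasoning
  open import Algebra.Bundles using (CommutativeSemiring)
  open BinomialFrobenius using (freshmans-dream)
  open OddPrimeModulus m prime
  open QuadraticExtension a
  open import Algebra.Properties.Monoid.Mult (CommutativeSemiring.+-monoid ring) using () renaming (_×_ to _·_)
  open Chebyshev

  infix 4 _≋_
  record _≋_ (x y : ℤ × ℤ) : Set where
    constructor _,_
    field
      fst≈ : proj₁ x ≈ proj₁ y
      snd≈ : proj₂ x ≈ proj₂ y
  open _≋_

  ≋-refl : ∀ {x} → x ≋ x
  ≋-refl = ≈-refl , ≈-refl

  ≋-reflexive : ∀ {x y} → x ≡ y → x ≋ y
  ≋-reflexive refl = ≋-refl

  ≋-sym : ∀ {x y} → x ≋ y → y ≋ x
  ≋-sym (e , f) = ≈-sym e , ≈-sym f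

  ≋-trans : ∀ {x y z} → x ≋ y → y ≋ z → x ≋ z
  ≋-trans (e , f) (e′ , f′) = ≈-trans e e′ , ≈-trans f f′

  ≋-setoid : Setoid _ _
  ≋-setoid = record
    { Carrier = ℤ × ℤ ; _≈_ = _≋_ ; isEquivalence = record { refl = ≋-refl ; sym = ≋-sym ; trans = ≋-trans } }

  module ≋-Reasoning = SetoidReasoning ≋-setoid

  ⊕-cong : ∀ {x x′ y y′} → x ≋ x′ → y ≋ y′ → x ⊕ y ≋ x′ ⊕ y′
  ⊕-cong (e , f) (e′ , f′) = +-cong e e′ , +-cong f f′

  ⊗-cong : ∀ {x x′ y y′} → x ≋ x′ → y ≋ y′ → x ⊗ y ≋ x′ ⊗ y′
  ⊗-cong (e , f) (e′ , f′) =
    -‿cong (*-cong e e′) (*-cong f f′) , +-cong (+-cong (*-cong e f′) (*-cong f e′)) (*-cong (≈-refl {a}) (*-cong f f′))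

  ^-congᴾ : ∀ {x y} n → x ≋ y → x ^ n ≋ y ^ n
  ^-congᴾ zero x≋y = ≋-refl
  ^-congᴾ (suc n) x≋y = ⊗-cong x≋y (^-congᴾ n x≋y)

  ι-cong : ∀ {u v} → u ≈ v → ι u ≋ ι v
  ι-cong u≈v = u≈v , ≈-refl

  ι-cancel : ∀ {k x y} → ¬ p∣ k → ι k ⊗ x ≋ ι k ⊗ y → x ≋ y
  ι-cancel {k} {u , v} {u′ , v′} p∤k kx≋ky = *-cancelˡ-≈ k p∤k (fst≈ k·≋k·) , *-cancelˡ-≈ k p∤k (snd≈ k·≋k·)
    where k·≋k· = ≋-trans (≋-reflexive (sym (ι⊗ k u v))) (≋-trans kx≋ky (≋-reflexive (ι⊗ k u′ v′)))

  ⊕-cancelʳ : ∀ z {x y} → x ⊕ z ≋ y ⊕ z → x ≋ y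
  ⊕-cancelʳ z (e , f) = +-cancelʳ-≈ (proj₁ z) e , +-cancelʳ-≈ (proj₂ z) f

  ·𝟙≡ι : ∀ k → k · 𝟙 ≡ ι (+ k)
  ·𝟙≡ι zero = refl
  ·𝟙≡ι (suc k) = cong (𝟙 ⊕_) (·𝟙≡ι k)

  frobeniusᴾ : ∀ x y → (x ⊕ y) ^ p ≋ x ^ p ⊕ y ^ p
  frobeniusᴾ x y = begin
    (x ⊕ y) ^ p                               ≡⟨ proj₂ dream ⟩
    (x ^ p ⊕ y ^ p) ⊕ (p · 𝟙) ⊗ w             ≡⟨ cong (λ k → (x ^ p ⊕ y ^ p) ⊕ k ⊗ w) (·𝟙≡ι p) ⟩
    (x ^ p ⊕ y ^ p) ⊕ ι (+ p) ⊗ w             ≡⟨ cong ((x ^ p ⊕ y ^ p) ⊕_) (ι⊗ (+ p) (proj₁ w) (proj₂ w)) ⟩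
    (x ^ p ⊕ y ^ p) ⊕ (+ p * proj₁ w , + p * proj₂ w)
                                              ≈⟨ ⊕-cong (≋-refl {x ^ p ⊕ y ^ p}) (multiple (proj₁ w) , multiple (proj₂ w)) ⟩
    (x ^ p ⊕ y ^ p) ⊕ 𝟘                       ≡⟨ ⊕-identityʳ (x ^ p ⊕ y ^ p) ⟩
    x ^ p ⊕ y ^ p                             ∎
    where
    open ≋-Reasoning
    dream = freshmans-dream ring prime x y
    w = proj₁ dream
    multiple : ∀ u → + p * u ≈ 0ℤ
    multiple u = ∣⇒≈0 (divides u (ℤP.*-comm (+ p) u))

  fermatᴾ : ∀ u → ι u ^ p ≋ ι u
  fermatᴾ u = ≋-trans (≋-reflexive (ι-^ u p)) (ι-cong (fermat u))

  D : ℤ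
  D = a * a - + 4

  √D^p : √D ^ p ≡ √D ⊗ ι (D ℤ.^ m)
  √D^p = cong (√D ⊗_) (begin
    √D ^ (m ℕ.+ m)     ≡⟨ ^-homo-* √D m m ⟩
    √D ^ m ⊗ √D ^ m    ≡⟨ sym (^-distrib-* √D √D m) ⟩
    (√D ⊗ √D) ^ m      ≡⟨ cong (_^ m) √D⊗√D ⟩
    ι D ^ m            ≡⟨ ι-^ D m ⟩
    ι (D ℤ.^ m)        ∎)
    where open ≡-Reasoning

  2X^p-a≋√D^p : ι (+ 2) ⊗ X ^ p ⊕ ι (- a) ≋ √D ⊗ ι (D ℤ.^ m)
  2X^p-a≋√D^p = begin
    ι (+ 2) ⊗ X ^ p ⊕ ι (- a)           ≈⟨ ⊕-cong (⊗-cong (≋-sym (fermatᴾ (+ 2))) (≋-refl {X ^ p}))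
                                                      (≋-sym (fermatᴾ (- a))) ⟩
    ι (+ 2) ^ p ⊗ X ^ p ⊕ ι (- a) ^ p   ≡⟨ cong (_⊕ ι (- a) ^ p) (sym (^-distrib-* (ι (+ 2)) X p)) ⟩
    (ι (+ 2) ⊗ X) ^ p ⊕ ι (- a) ^ p     ≈⟨ ≋-sym (frobeniusᴾ (ι (+ 2) ⊗ X) (ι (- a))) ⟩
    (ι (+ 2) ⊗ X ⊕ ι (- a)) ^ p         ≡⟨ cong (_^ p) (sym √D≡2X-a) ⟩
    √D ^ p                              ≡⟨ √D^p ⟩
    √D ⊗ ι (D ℤ.^ m)                    ∎
    where open ≋-Reasoning

  X^p≋X : D ℤ.^ m ≈ 1ℤ → X ^ p ≋ X
  X^p≋X Dᵐ≈1 = ι-cancel ∤2 (⊕-cancelʳ (ι (- a)) (begin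
    ι (+ 2) ⊗ X ^ p ⊕ ι (- a)    ≈⟨ 2X^p-a≋√D^p ⟩
    √D ⊗ ι (D ℤ.^ m)             ≈⟨ ⊗-cong (≋-refl {√D}) (ι-cong Dᵐ≈1) ⟩
    √D ⊗ 𝟙                       ≡⟨ ⊗-identityʳ √D ⟩
    √D                           ≡⟨ √D≡2X-a ⟩
    ι (+ 2) ⊗ X ⊕ ι (- a)        ∎))
    where open ≋-Reasoning

  X^p≋X̄ : D ℤ.^ m ≈ - 1ℤ → X ^ p ≋ X̄
  X^p≋X̄ Dᵐ≈-1 = ι-cancel ∤2 (⊕-cancelʳ (ι (- a)) (begin
    ι (+ 2) ⊗ X ^ p ⊕ ι (- a)    ≈⟨ 2X^p-a≋√D^p ⟩
    √D ⊗ ι (D ℤ.^ m)             ≈⟨ ⊗-cong (≋-refl {√D}) (ι-cong Dᵐ≈-1) ⟩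
    √D ⊗ ι (- 1ℤ)                ≡⟨ √D⊗ι[-1] ⟩
    ι (+ 2) ⊗ X̄ ⊕ ι (- a)        ∎))
    where open ≋-Reasoning

  Y^p≋X^p⊕𝟙 : Y ^ p ≋ X ^ p ⊕ 𝟙
  Y^p≋X^p⊕𝟙 = ≋-trans (frobeniusᴾ X 𝟙) (≋-reflexive (cong (X ^ p ⊕_) (𝟙^ p)))

  Y^[1+p] : Y ^ suc p ≡ ι ((a + + 2) ℤ.^ suc m) ⊗ X ^ suc m
  Y^[1+p] = begin
    Y ^ suc p                                     ≡⟨ cong (λ k → Y ^ suc k) (sym (ℕP.+-suc m m)) ⟩
    Y ^ (suc m ℕ.+ suc m)                         ≡⟨ ^-homo-* Y (suc m) (suc m) ⟩
    Y ^ suc m ⊗ Y ^ suc m                         ≡⟨ sym (^-distrib-* Y Y (suc m)) ⟩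
    (Y ⊗ Y) ^ suc m                               ≡⟨ cong (_^ suc m) Y⊗Y ⟩
    (ι (a + + 2) ⊗ X) ^ suc m                     ≡⟨ ^-distrib-* (ι (a + + 2)) X (suc m) ⟩
    ι (a + + 2) ^ suc m ⊗ X ^ suc m               ≡⟨ cong (_⊗ X ^ suc m) (ι-^ (a + + 2) (suc m)) ⟩
    ι ((a + + 2) ℤ.^ suc m) ⊗ X ^ suc m           ∎
    where open ≡-Reasoning

  -- Compare Y^(p+1) = ((a + 2)X)^(m+1), where (a + 2)^m = −1, with Y · Y^p = Y (X^p + 1).
  module _ (nonsquare : ∀ y → ¬ y * y ≈ a + + 2) where

    private
      c = a + + 2

    p∤-c : ¬ p∣ (- c)
    p∤-c p∣-c = nonsquare 0ℤ (≈-sym (∣⇒≈0 (∣-resp-≡ (ℤP.neg-involutive c) (∣m⇒∣-m p∣-c))))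

    Y⊗Y^p : Y ⊗ Y ^ p ≋ ι (- c) ⊗ X ^ suc m
    Y⊗Y^p = ≋-trans (≋-reflexive Y^[1+p]) (⊗-cong (ι-cong c^[1+m]≈-c) (≋-refl {X ^ suc m}))
      where
      c^[1+m]≈-c : c ℤ.^ suc m ≈ - c
      c^[1+m]≈-c = ≈-trans (*-cong (≈-refl {c}) (euler-nonsquare nonsquare))
                           (≈-reflexive (trans (ℤP.*-comm c (- 1ℤ)) (ℤP.-1*i≡-i c)))

    -c⊗-1 : ι (- c) ⊗ ι (- 1ℤ) ≡ ι c
    -c⊗-1 = trans (ι-⊗ (- c) (- 1ℤ)) (cong ι (negate c))
      where negate : ∀ c → - c * - 1ℤ ≡ c
            negate = solve-∀

    X^m≋-1 : D ℤ.^ m ≈ 1ℤ → X ^ m ≋ ι (- 1ℤ)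
    X^m≋-1 Dᵐ≈1 = begin
      X ^ m                         ≡⟨ sym (X̄⊗X^[1+n] m) ⟩
      X̄ ⊗ X ^ suc m                 ≈⟨ ⊗-cong (≋-refl {X̄}) X^[1+m]≋-X ⟩
      X̄ ⊗ (ι (- 1ℤ) ⊗ X)           ≡⟨ X̄⊗[k⊗X] (- 1ℤ) ⟩
      ι (- 1ℤ)                      ∎
      where
      open ≋-Reasoning
      X^[1+m]≋-X : X ^ suc m ≋ ι (- 1ℤ) ⊗ X
      X^[1+m]≋-X = ι-cancel p∤-c (begin
        ι (- c) ⊗ X ^ suc m             ≈⟨ ≋-sym Y⊗Y^p ⟩
        Y ⊗ Y ^ p                       ≈⟨ ⊗-cong (≋-refl {Y}) (≋-trans Y^p≋X^p⊕𝟙 (⊕-cong (X^p≋X Dᵐ≈1) (≋-refl {𝟙}))) ⟩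
        Y ⊗ Y                           ≡⟨ Y⊗Y ⟩
        ι c ⊗ X                         ≡⟨ cong (_⊗ X) (sym -c⊗-1) ⟩
        ι (- c) ⊗ ι (- 1ℤ) ⊗ X          ≡⟨ ⊗-assoc (ι (- c)) (ι (- 1ℤ)) X ⟩
        ι (- c) ⊗ (ι (- 1ℤ) ⊗ X)        ∎)

    X^[1+m]≋-1 : D ℤ.^ m ≈ - 1ℤ → X ^ suc m ≋ ι (- 1ℤ)
    X^[1+m]≋-1 Dᵐ≈-1 = ι-cancel p∤-c (begin
      ι (- c) ⊗ X ^ suc m               ≈⟨ ≋-sym Y⊗Y^p ⟩
      Y ⊗ Y ^ p                         ≈⟨ ⊗-cong (≋-refl {Y}) (≋-trans Y^p≋X^p⊕𝟙 (⊕-cong (X^p≋X̄ Dᵐ≈-1) (≋-refl {𝟙}))) ⟩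
      Y ⊗ (X̄ ⊕ 𝟙)                       ≡⟨ Y⊗[X̄⊕𝟙] ⟩
      ι c                               ≡⟨ sym -c⊗-1 ⟩
      ι (- c) ⊗ ι (- 1ℤ)                ∎)
      where open ≋-Reasoning

  -- C_t(a) = X̄^t (X^(2t) + 1).
  Cℤ≈0 : ∀ t → X ^ (t ℕ.+ t) ≋ ι (- 1ℤ) → Cℤ t a ≈ 0ℤ
  Cℤ≈0 t X^2t≋-1 = fst≈ (begin
    ι (Cℤ t a)                                  ≡⟨ sym (X̄^n⊗[X^n⊗x] t (ι (Cℤ t a))) ⟩
    X̄ ^ t ⊗ (X ^ t ⊗ ι (Cℤ t a))                ≡⟨ cong (λ x → X̄ ^ t ⊗ (X ^ t ⊗ x)) (sym (X^+X̄^ t)) ⟩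
    X̄ ^ t ⊗ (X ^ t ⊗ (X ^ t ⊕ X̄ ^ t))          ≡⟨ cong (X̄ ^ t ⊗_) (⊗-distribˡ-⊕ (X ^ t) (X ^ t) (X̄ ^ t)) ⟩
    X̄ ^ t ⊗ (X ^ t ⊗ X ^ t ⊕ X ^ t ⊗ X̄ ^ t)    ≡⟨ cong (λ x → X̄ ^ t ⊗ (x ⊕ X ^ t ⊗ X̄ ^ t)) (sym (^-homo-* X t t)) ⟩
    X̄ ^ t ⊗ (X ^ (t ℕ.+ t) ⊕ X ^ t ⊗ X̄ ^ t)    ≡⟨ cong (λ x → X̄ ^ t ⊗ (X ^ (t ℕ.+ t) ⊕ x)) (X^n⊗X̄^n t) ⟩
    X̄ ^ t ⊗ (X ^ (t ℕ.+ t) ⊕ 𝟙)                ≈⟨ ⊗-cong (≋-refl {X̄ ^ t}) (⊕-cong X^2t≋-1 (≋-refl {𝟙})) ⟩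
    X̄ ^ t ⊗ (ι (- 1ℤ) ⊕ 𝟙)                     ≡⟨ ⊗-zeroʳ (X̄ ^ t) ⟩
    𝟘                                           ∎)
    where open ≋-Reasoning

module RationalReduction (m : ℕ) (prime : Prime (suc (m ℕ.+ m))) where

  import Data.Nat.Properties as ℕP
  import Data.Nat.Coprimality as Coprimality
  open import Data.Integer using (+_; _+_; _*_; _-_; -_; 0ℤ; 1ℤ)
  import Data.Integer.Properties as ℤP
  open import Data.Integer.Divisibility.Signed using (∣⇒∣ᵤ; ∣ᵤ⇒∣; ∣n⇒∣m*n; ∣m⇒∣m*n; ∣m∣n⇒∣m-n)
  open import Data.Integer.GCD using (gcd)
  open import Data.Integer.Tactic.RingSolver using (solve-∀)
  open import Data.Rational as ℚ using (ℚ; ↥_; ↧_; ↧ₙ_; _/_)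
  import Data.Rational.Properties as ℚP
  open import Data.Product using (∃-syntax; _,_; proj₁; proj₂)
  open import Data.Sum using ([_,_]′)
  open import Data.Empty using (⊥; ⊥-elim)
  open import Relation.Nullary using (¬_)
  open import Relation.Binary.PropositionalEquality using (_≡_; sym; trans; cong)
  open import Defs using (U; C; _∣ℚ_; _≡[_]_; δ; SqModP)
  open OddPrimeModulus m prime
  open BinomialFrobenius using (prime>1)
  open Chebyshev

  infix 4 _↦_
  record _↦_ (x : ℚ) (r : ℤ) : Set where
    constructor reduction
    field
      p∤↧ : ¬ p∣ ↧ x
      ↥≈r↧ : ↥ x ≈ r * ↧ x
  open _↦_ public

  ↦-/ : ∀ i n .{{_ : ℕ.NonZero n}} {r} → ¬ p∣ + n → i ≈ r * + n → i / n ↦ r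
  ↦-/ i n {r} p∤n i≈rn = reduction p∤↧[i/n] (*-cancelˡ-≈ g p∤g (begin
      g * ↥ (i / n)          ≡⟨ trans (ℤP.*-comm g _) (ℚP.↥-/ i n) ⟩
      i                      ≈⟨ i≈rn ⟩
      r * + n                ≡⟨ cong (r *_) (sym (ℚP.↧-/ i n)) ⟩
      r * (↧ (i / n) * g)    ≡⟨ regroup r (↧ (i / n)) g ⟩
      g * (r * ↧ (i / n))    ∎))
    where
    open ≈-Reasoning
    g = gcd i (+ n)
    p∤↧[i/n] : ¬ p∣ ↧ (i / n)
    p∤↧[i/n] p∣↧ = p∤n (∣-resp-≡ (ℚP.↧-/ i n) (∣m⇒∣m*n g p∣↧))
    p∤g : ¬ p∣ g
    p∤g p∣g = p∤n (∣-resp-≡ (ℚP.↧-/ i n) (∣n⇒∣m*n (↧ (i / n)) p∣g))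
    regroup : ∀ r d g → r * (d * g) ≡ g * (r * d)
    regroup = solve-∀

  p∤↧*↧ : ∀ {x y} → ¬ p∣ ↧ x → ¬ p∣ ↧ y → ¬ p∣ + (↧ₙ x ℕ.* ↧ₙ y)
  p∤↧*↧ {x} {y} p∤↧x p∤↧y p∣ = ∤*∤⇒∤* p∤↧x p∤↧y (∣-resp-≡ (ℤP.pos-* (↧ₙ x) (↧ₙ y)) p∣)

  ↦-+ : ∀ {x y r s} → x ↦ r → y ↦ s → x ℚ.+ y ↦ r + s
  ↦-+ {x@record{}} {y@record{}} {r} {s} (reduction p∤↧x ↥x≈) (reduction p∤↧y ↥y≈) =
    ↦-/ (↥ x * ↧ y + ↥ y * ↧ x) (↧ₙ x ℕ.* ↧ₙ y) (p∤↧*↧ {x} {y} p∤↧x p∤↧y) (begin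
      ↥ x * ↧ y + ↥ y * ↧ x            ≈⟨ +-cong (*-cong ↥x≈ (≈-refl {↧ y})) (*-cong ↥y≈ (≈-refl {↧ x})) ⟩
      r * ↧ x * ↧ y + s * ↧ y * ↧ x    ≡⟨ regroup r s (↧ x) (↧ y) ⟩
      (r + s) * (↧ x * ↧ y)            ≡⟨ cong ((r + s) *_) (sym (ℤP.pos-* (↧ₙ x) (↧ₙ y))) ⟩
      (r + s) * + (↧ₙ x ℕ.* ↧ₙ y)      ∎)
    where
    open ≈-Reasoning
    regroup : ∀ r s u v → r * u * v + s * v * u ≡ (r + s) * (u * v)
    regroup = solve-∀

  ↦-* : ∀ {x y r s} → x ↦ r → y ↦ s → x ℚ.* y ↦ r * s
  ↦-* {x@record{}} {y@record{}} {r} {s} (reduction p∤↧x ↥x≈) (reduction p∤↧y ↥y≈) =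
    ↦-/ (↥ x * ↥ y) (↧ₙ x ℕ.* ↧ₙ y) (p∤↧*↧ {x} {y} p∤↧x p∤↧y) (begin
      ↥ x * ↥ y                        ≈⟨ *-cong ↥x≈ ↥y≈ ⟩
      r * ↧ x * (s * ↧ y)              ≡⟨ regroup r s (↧ x) (↧ y) ⟩
      (r * s) * (↧ x * ↧ y)            ≡⟨ cong ((r * s) *_) (sym (ℤP.pos-* (↧ₙ x) (↧ₙ y))) ⟩
      (r * s) * + (↧ₙ x ℕ.* ↧ₙ y)      ∎)
    where
    open ≈-Reasoning
    regroup : ∀ r s u v → r * u * (s * v) ≡ (r * s) * (u * v)
    regroup = solve-∀

  ↦-neg : ∀ {x r} → x ↦ r → ℚ.- x ↦ - r
  ↦-neg {x} {r} (reduction p∤↧x ↥x≈) =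
    reduction (λ p∣↧ → p∤↧x (∣-resp-≡ (ℚP.↧-neg x) p∣↧)) (begin
      ↥ (ℚ.- x)        ≡⟨ ℚP.↥-neg x ⟩
      - ↥ x            ≈⟨ neg-cong ↥x≈ ⟩
      - (r * ↧ x)      ≡⟨ ℤP.neg-distribˡ-* r (↧ x) ⟩
      - r * ↧ x        ≡⟨ cong (- r *_) (sym (ℚP.↧-neg x)) ⟩
      - r * ↧ (ℚ.- x)  ∎)
    where open ≈-Reasoning

  ↦-minus : ∀ {x y r s} → x ↦ r → y ↦ s → x ℚ.- y ↦ r - s
  ↦-minus {x} {y} {r} {s} x↦r y↦s = ↦-+ {x} {ℚ.- y} {r} { - s} x↦r (↦-neg y↦s)

  ↦-ℕ : ∀ k → + k / 1 ↦ + k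
  ↦-ℕ k = ↦-/ (+ k) 1 ∤1 (≈-reflexive (sym (ℤP.*-identityʳ (+ k))))

  ↦-U : ∀ {q r} → q ↦ r → ∀ n → U n q ↦ Uℤ n r
  ↦-U q↦r zero = ↦-ℕ 0
  ↦-U q↦r (suc zero) = ↦-ℕ 1
  ↦-U {q} {r} q↦r (suc (suc n)) =
    ↦-minus {q ℚ.* U (suc n) q} {U n q} {r * Uℤ (suc n) r} {Uℤ n r}
        (↦-* {q} {U (suc n) q} q↦r (↦-U q↦r (suc n))) (↦-U q↦r n)

  ↦-C : ∀ {q r} → q ↦ r → ∀ n → C n q ↦ Cℤ n r
  ↦-C q↦r zero = ↦-ℕ 2
  ↦-C {q} {r} q↦r (suc n) =
    ↦-minus {U (suc (suc n)) q} {U n q} {Uℤ (suc (suc n)) r} {Uℤ n r} (↦-U q↦r (suc (suc n))) (↦-U q↦r n)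

  ∣ℚ⇒≈0 : ∀ {x r} → x ↦ r → p ∣ℚ x → r ≈ 0ℤ
  ∣ℚ⇒≈0 {x} {r} (reduction p∤↧x ↥x≈) p∣↥x =
    [ ∣⇒≈0 , (λ p∣↧x → ⊥-elim (p∤↧x p∣↧x)) ]′ (∣*⇒∣⊎∣ r (↧ x) (≈0⇒∣ (≈-trans (≈-sym ↥x≈) (∣⇒≈0 (∣ᵤ⇒∣ p∣↥x)))))

  ≈0⇒∣ℚ : ∀ {x r} → x ↦ r → r ≈ 0ℤ → p ∣ℚ x
  ≈0⇒∣ℚ {x} (reduction _ ↥x≈) r≈0 = ∣⇒∣ᵤ (≈0⇒∣ (≈-trans ↥x≈ (*-cong r≈0 (≈-refl {↧ x}))))

  ≡[p]⇒≈ : ∀ {x y r s} → x ↦ r → y ↦ s → x ≡[ p ] y → r ≈ s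
  ≡[p]⇒≈ {x} {y} {r} {s} x↦r y↦s x≡y = mod (≈0⇒∣ (∣ℚ⇒≈0 {x ℚ.- y} {r - s} (↦-minus {x} {y} x↦r y↦s) x≡y))

  ≈⇒≡[p] : ∀ {x y r s} → x ↦ r → y ↦ s → r ≈ s → x ≡[ p ] y
  ≈⇒≡[p] {x} {y} {r} {s} x↦r y↦s (mod p∣r-s) = ≈0⇒∣ℚ {x ℚ.- y} {r - s} (↦-minus {x} {y} x↦r y↦s) (∣⇒≈0 p∣r-s)

  ↦-reduce : ∀ {x} → ¬ p∣ ↧ x → ∃[ r ] x ↦ r
  ↦-reduce {x} p∤↧x = ↥ x * w , reduction p∤↧x (begin
    ↥ x                  ≡⟨ sym (ℤP.*-identityʳ (↥ x)) ⟩
    ↥ x * 1ℤ             ≈⟨ *-cong (≈-refl {↥ x}) (≈-sym ↧x*w≈1) ⟩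
    ↥ x * (↧ x * w)      ≡⟨ regroup (↥ x) (↧ x) w ⟩
    ↥ x * w * ↧ x        ∎)
    where
    open ≈-Reasoning
    w = proj₁ (inverse p∤↧x)
    ↧x*w≈1 = proj₂ (inverse p∤↧x)
    regroup : ∀ n d w → n * (d * w) ≡ n * w * d
    regroup = solve-∀

  ¬p∣↥×↧ : ∀ x → p∣ ↥ x → p∣ ↧ x → ⊥
  ¬p∣↥×↧ (ℚ.mkℚ _ _ coprime) p∣↥ p∣↧ = ℕP.<⇒≢ (prime>1 prime)
    (sym (Coprimality.recompute coprime (∣⇒∣ᵤ p∣↥ , ∣⇒∣ᵤ p∣↧)))

  p∣↧/ : ∀ i n .{{_ : ℕ.NonZero n}} → p∣ + n → ¬ p∣ i → p∣ ↧ (i / n)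
  p∣↧/ i n p∣n p∤i =
    [ (λ p∣↧ → p∣↧) , (λ p∣g → ⊥-elim (p∤i (∣-resp-≡ (ℚP.↥-/ i n) (∣n⇒∣m*n (↥ (i / n)) p∣g)))) ]′
      (∣*⇒∣⊎∣ (↧ (i / n)) (gcd i (+ n)) (∣-resp-≡ (sym (ℚP.↧-/ i n)) p∣n))

  p∣↧⇒p∣↧[x*x] : ∀ {x} → p∣ ↧ x → p∣ ↧ (x ℚ.* x)
  p∣↧⇒p∣↧[x*x] {x@record{}} p∣↧x =
    p∣↧/ (↥ x * ↥ x) (↧ₙ x ℕ.* ↧ₙ x) (∣-resp-≡ (sym (ℤP.pos-* (↧ₙ x) (↧ₙ x))) (∣m⇒∣m*n (↧ x) p∣↧x))
      (∤*∤⇒∤* p∤↥x p∤↥x)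
    where p∤↥x : ¬ p∣ ↥ x
          p∤↥x p∣↥x = ¬p∣↥×↧ x p∣↥x p∣↧x

  p∣↧⇒p∣↧[x+y] : ∀ {x y} → p∣ ↧ x → ¬ p∣ ↧ y → p∣ ↧ (x ℚ.+ y)
  p∣↧⇒p∣↧[x+y] {x@record{}} {y@record{}} p∣↧x p∤↧y =
    p∣↧/ (↥ x * ↧ y + ↥ y * ↧ x) (↧ₙ x ℕ.* ↧ₙ y) (∣-resp-≡ (sym (ℤP.pos-* (↧ₙ x) (↧ₙ y))) (∣m⇒∣m*n (↧ y) p∣↧x))
      (λ p∣num → ∤*∤⇒∤* p∤↥x p∤↧y (∣-resp-≡ (cancel (↥ x * ↧ y) (↥ y * ↧ x))
                                                 (∣m∣n⇒∣m-n p∣num (∣n⇒∣m*n (↥ y) p∣↧x))))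
    where
    p∤↥x : ¬ p∣ ↥ x
    p∤↥x p∣↥x = ¬p∣↥×↧ x p∣↥x p∣↧x
    cancel : ∀ u v → u + v - v ≡ u
    cancel = solve-∀

  p∣↧⇒p∣↧δ : ∀ q → p∣ ↧ q → p∣ ↧ (δ q)
  p∣↧⇒p∣↧δ q p∣↧q = p∣↧⇒p∣↧[x+y] {q ℚ.* q} {ℚ.- (+ 4 / 1)} (p∣↧⇒p∣↧[x*x] {q} p∣↧q) ∤1

  ↦-resp-≈ : ∀ {x r s} → x ↦ r → r ≈ s → x ↦ s
  ↦-resp-≈ {x} (reduction p∤↧x ↥x≈) r≈s = reduction p∤↧x (≈-trans ↥x≈ (*-cong r≈s (≈-refl {↧ x})))

  SqModP⇒square : ∀ {x r} → x ↦ r → SqModP x p → ∃[ y ] y * y ≈ r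
  SqModP⇒square {x} {r} (reduction p∤↧x ↥x≈) (y , p∣y²-↥↧) = square-*-unit² p∤↧x (y , (begin
    y * y                  ≈⟨ mod (∣ᵤ⇒∣ p∣y²-↥↧) ⟩
    ↥ x * ↧ x              ≈⟨ *-cong ↥x≈ (≈-refl {↧ x}) ⟩
    r * ↧ x * ↧ x          ≡⟨ ℤP.*-assoc r (↧ x) (↧ x) ⟩
    r * (↧ x * ↧ x)        ∎))
    where open ≈-Reasoning

  square⇒SqModP : ∀ {x r} → x ↦ r → ∃[ y ] y * y ≈ r → SqModP x p
  square⇒SqModP {x} {r} (reduction _ ↥x≈) r-square with square⇒square-*-unit² (↧ x) r-square
  ... | y , y²≈r↧² = y , ∣⇒∣ᵤ (divides-difference (begin
    y * y                  ≈⟨ y²≈r↧² ⟩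
    r * (↧ x * ↧ x)        ≡⟨ sym (ℤP.*-assoc r (↧ x) (↧ x)) ⟩
    r * ↧ x * ↧ x          ≈⟨ *-cong (≈-sym ↥x≈) (≈-refl {↧ x}) ⟩
    ↥ x * ↧ x              ∎))
    where open ≈-Reasoning

module Parity where

  open import Data.Nat using (_+_; _*_; _^_)
  import Data.Nat.Properties as ℕP
  open import Data.Nat.Divisibility using (_∣_; divides; ∣-refl; ∣m∣n⇒∣m+n)
  import Data.Nat.Tactic.RingSolver as ℕSolver
  open import Data.Product using (∃-syntax; _×_; _,_)
  open import Data.Empty using (⊥-elim)
  open import Relation.Nullary using (¬_)
  open import Relation.Binary.PropositionalEquality using (_≡_; refl; sym; trans; cong)
  open import Defs using (_∥_)

  odd⇒1+2* : ∀ n → ¬ 2 ∣ n → ∃[ m ] n ≡ suc (m + m)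
  odd⇒1+2* zero 2∤0 = ⊥-elim (2∤0 (divides 0 refl))
  odd⇒1+2* (suc zero) _ = 0 , refl
  odd⇒1+2* (suc (suc n)) 2∤2+n with odd⇒1+2* n (λ 2∣n → 2∤2+n (∣m∣n⇒∣m+n ∣-refl 2∣n))
  ... | m , refl = suc m , cong (λ k → suc (suc k)) (sym (ℕP.+-suc m m))

  2h≡n+n⇒h≡n : ∀ {h n} → 2 * h ≡ n + n → h ≡ n
  2h≡n+n⇒h≡n {h} {n} 2h≡n+n = ℕP.*-cancelˡ-≡ h n 2 (trans 2h≡n+n (double n))
    where double : ∀ n → n + n ≡ 2 * n
          double = ℕSolver.solve-∀

  odd-part : ∀ {e h} → e ∥ h → ∃[ o ] ¬ 2 ∣ o × h ≡ o * 2 ^ e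
  odd-part {e} {h} (divides o h≡o*2ᵉ , 2¹⁺ᵉ∤h) = o , o-odd , h≡o*2ᵉ
    where
    regroup : ∀ o′ x → o′ * 2 * x ≡ o′ * (2 * x)
    regroup = ℕSolver.solve-∀
    o-odd : ¬ 2 ∣ o
    o-odd (divides o′ o≡o′*2) =
      2¹⁺ᵉ∤h (divides o′ (trans h≡o*2ᵉ (trans (cong (_* 2 ^ e) o≡o′*2) (regroup o′ (2 ^ e)))))

open import Data.Product using (_,_; proj₁)
open import Defs

Ω⇒Π′ : ∀ σ j {q₀ p} → Ω σ j q₀ p → Π' q₀ p
Ω⇒Π′ σ zero π′ = π′
Ω⇒Π′ σ (suc j) (π′ , _) = π′

module Inclusion (m : ℕ) (prime : Prime (suc (m ℕ.+ m))) where

  import Data.Nat.Properties as ℕP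
  import Data.Nat.Tactic.RingSolver as ℕSolver
  open import Data.Integer using (+_; -[1+_]; _+_; _*_; _-_; -_; 0ℤ; 1ℤ; _%ℕ_)
  import Data.Integer.Properties as ℤP
  open import Data.Integer.DivMod using (n%ℕd<d)
  open import Data.Integer.Divisibility.Signed using (∣⇒∣ᵤ; ∣ᵤ⇒∣; ∣n⇒∣m*n; ∣m⇒∣m*n)
  open import Data.Integer.Tactic.RingSolver using (solve-∀)
  open import Data.Rational as ℚ using (↧_; _/_)
  open import Data.Product using (∃-syntax; _,_; proj₁; proj₂)
  open import Data.Sum using (inj₁; inj₂)
  open import Data.Empty using (⊥-elim)
  open import Relation.Nullary using (¬_)
  open import Relation.Binary.PropositionalEquality using (_≡_; refl; sym; trans; cong; subst)
  open OddPrimeModulus m prime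
  open RationalReduction m prime
  open Chebyshev
  open Parity using (2h≡n+n⇒h≡n; odd-part)

  Π′⇒p∤↧ : ∀ {q₀} → Π' q₀ p → ¬ p∣ ↧ q₀
  Π′⇒p∤↧ {q₀} (_ , _ , p∤↧δ) p∣↧q₀ = p∤↧δ (∣⇒∣ᵤ (p∣↧⇒p∣↧δ q₀ p∣↧q₀))

  Ω⁺-witness : ∀ j {q₀ r₀} → q₀ ↦ r₀ → Ω plus j q₀ p → ∃[ a ] Cℤ (2 ℕ.^ j) a ≈ r₀
  Ω⁺-witness zero {r₀ = r₀} _ _ = r₀ , ≈-reflexive (Cℤ-1 r₀)
  Ω⁺-witness (suc j) {q₀} {r₀} q₀↦r₀ (_ , a , _ , C≡q₀) =
    + a , ≡[p]⇒≈ {C (2 ℕ.^ suc j) (+ a / 1)} {q₀} (↦-C (↦-ℕ a) (2 ℕ.^ suc j)) q₀↦r₀ C≡q₀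

  ¬Ω⁺⇒nonsquare : ∀ j {q₀ r₀ a} → Π' q₀ p → q₀ ↦ r₀ → Cℤ (2 ℕ.^ j) a ≈ r₀ →
                  ¬ Ω plus (suc j) q₀ p → ∀ y → ¬ y * y ≈ a + + 2
  ¬Ω⁺⇒nonsquare j {q₀} {r₀} {a} π′ q₀↦r₀ Cℤa≈r₀ ¬Ω⁺ y y²≈a+2 =
    ¬Ω⁺ (π′ , b , n%ℕd<d y p ,
         ≈⇒≡[p] {C (2 ℕ.^ suc j) (+ b / 1)} {q₀} (↦-C (↦-ℕ b) (2 ℕ.^ suc j)) q₀↦r₀ Cℤb≈r₀)
    where
    open ≈-Reasoning
    b = y %ℕ p
    cancel : ∀ a → a + + 2 - + 2 ≡ a
    cancel = solve-∀
    Cℤ₂b≈a : Cℤ 2 (+ b) ≈ a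
    Cℤ₂b≈a = begin
      Cℤ 2 (+ b)           ≈⟨ Cℤ-congʳ 2 (≈-sym (≈-remainder y)) ⟩
      Cℤ 2 y               ≡⟨ Cℤ-2 y ⟩
      y * y - + 2          ≈⟨ -‿cong y²≈a+2 (≈-refl {+ 2}) ⟩
      a + + 2 - + 2        ≡⟨ cancel a ⟩
      a                    ∎
    Cℤb≈r₀ : Cℤ (2 ℕ.^ suc j) (+ b) ≈ r₀
    Cℤb≈r₀ = begin
      Cℤ (2 ℕ.^ suc j) (+ b)            ≡⟨ sym (Cℤ-∘ (2 ℕ.^ j) 2 (+ b)) ⟩
      Cℤ (2 ℕ.^ j) (Cℤ 2 (+ b))         ≈⟨ Cℤ-congʳ (2 ℕ.^ j) Cℤ₂b≈a ⟩
      Cℤ (2 ℕ.^ j) a                    ≈⟨ Cℤa≈r₀ ⟩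
      r₀                                ∎

  δ↦Du² : ∀ {q₀ r₀ a} K → q₀ ↦ r₀ → Cℤ K a ≈ r₀ → δ q₀ ↦ (a * a - + 4) * (Uℤ K a * Uℤ K a)
  δ↦Du² {q₀} {r₀} {a} K q₀↦r₀ Cℤa≈r₀ =
    ↦-resp-≈ (↦-minus {q₀ ℚ.* q₀} {+ 4 / 1} {r₀ * r₀} {+ 4} (↦-* {q₀} {q₀} q₀↦r₀ q₀↦r₀) (↦-ℕ 4)) (begin
      r₀ * r₀ - + 4                   ≈⟨ -‿cong (*-cong (≈-sym Cℤa≈r₀) (≈-sym Cℤa≈r₀)) (≈-refl {+ 4}) ⟩
      Cℤ K a * Cℤ K a - + 4           ≡⟨ Cℤ²-4 K a ⟩
      (a * a - + 4) * (Uℤ K a * Uℤ K a) ∎)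
    where open ≈-Reasoning

  2h+1≡p⇒h≡m : ∀ {h} → + (2 ℕ.* h) + + 1 ≡ + p → h ≡ m
  2h+1≡p⇒h≡m {h} eq = 2h≡n+n⇒h≡n (ℕP.suc-injective (trans (ℕP.+-comm 1 (2 ℕ.* h)) (ℤP.+-injective eq)))

  2h-1≡p⇒h≡1+m : ∀ {h} → + (2 ℕ.* h) + -[1+ 0 ] ≡ + p → h ≡ suc m
  2h-1≡p⇒h≡1+m {h} eq = 2h≡n+n⇒h≡n (trans (ℤP.+-injective (trans (shift (+ (2 ℕ.* h))) (cong (_+ 1ℤ) eq))) (index m))
    where
    shift : ∀ x → x ≡ x + -[1+ 0 ] + 1ℤ
    shift = solve-∀
    index : ∀ m → suc (m ℕ.+ m) ℕ.+ 1 ≡ suc m ℕ.+ suc m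
    index = ℕSolver.solve-∀

  module _ (a : ℤ) where

    open QuadraticExtension a
    open QuadraticExtensionModulo m prime a

    X^p̂≋-1 : ∀ {q₀ h} K → Π' q₀ p → δ q₀ ↦ D * (Uℤ K a * Uℤ K a) → (∀ y → ¬ y * y ≈ a + + 2) →
             IsHat q₀ p h → X ^ h ≋ ι (- 1ℤ)
    X^p̂≋-1 {q₀} {h} K (_ , p∤↥δ , _) δ↦Du² nonsquare (_ , legendre , 2h+l≡p) = by-legendre legendre 2h+l≡p
      where
      u = Uℤ K a
      p∤Du² : ¬ p∣ D * (u * u)
      p∤Du² p∣ = p∤↥δ (≈0⇒∣ℚ {δ q₀} {D * (u * u)} δ↦Du² (∣⇒≈0 p∣))
      p∤D : ¬ p∣ D
      p∤D p∣D = p∤Du² (∣m⇒∣m*n (u * u) p∣D)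
      p∤u : ¬ p∣ u
      p∤u p∣u = p∤Du² (∣n⇒∣m*n D (∣m⇒∣m*n u p∣u))
      X^_≋-1 : ℕ → Set
      X^ n ≋-1 = X ^ n ≋ ι (- 1ℤ)
      by-legendre : ∀ {l} → Legendre (δ q₀) p l → + (2 ℕ.* h) + l ≡ + p → X^ h ≋-1
      by-legendre (inj₁ (refl , _ , δ-square)) 2h+1≡p =
        subst X^_≋-1 (sym (2h+1≡p⇒h≡m {h} 2h+1≡p)) (X^m≋-1 nonsquare (euler-square {D} y p∤D y²≈D))
        where
        D-square = square-*-unit² {D} {u} p∤u (SqModP⇒square {δ q₀} {D * (u * u)} δ↦Du² δ-square)
        y = proj₁ D-square
        y²≈D = proj₂ D-square
      by-legendre (inj₂ (inj₁ (refl , _ , δ-nonsquare))) 2h-1≡p =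
        subst X^_≋-1 (sym (2h-1≡p⇒h≡1+m {h} 2h-1≡p))
          (X^[1+m]≋-1 nonsquare (euler-nonsquare {D} D-nonsquare))
        where
        D-nonsquare : ∀ y → ¬ y * y ≈ D
        D-nonsquare y y²≈D =
          δ-nonsquare (square⇒SqModP {δ q₀} {D * (u * u)} δ↦Du² (square⇒square-*-unit² {D} u (y , y²≈D)))
      by-legendre (inj₂ (inj₂ (_ , p∣↥δ))) _ = ⊥-elim (p∤↥δ p∣↥δ)

  Z⇒Π : ∀ {q₀} j s h → Z (suc j) q₀ p → IsHat q₀ p h → (suc j ℕ.+ s) ∥ h → Π s q₀ p
  Z⇒Π {q₀} j s h ((Ω⁺ⱼ , _) , ¬Ω⁺ , _) hat 2^[1+j+s]∥h =
    proj₁ π′ , (λ p∣↧q₀ → p∤↧q₀ (∣ᵤ⇒∣ p∣↧q₀)) , o , o-odd ,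
    ≈0⇒∣ℚ {C N q₀} {Cℤ N r₀} (↦-C {q₀} {r₀} q₀↦r₀ N) Cℤ[N]r₀≈0
    where
    open ≈-Reasoning
    π′ = Ω⇒Π′ plus j Ω⁺ⱼ
    p∤↧q₀ = Π′⇒p∤↧ {q₀} π′
    r₀ = proj₁ (↦-reduce {q₀} p∤↧q₀)
    q₀↦r₀ = proj₂ (↦-reduce {q₀} p∤↧q₀)
    K = 2 ℕ.^ j
    a = proj₁ (Ω⁺-witness j {q₀} {r₀} q₀↦r₀ Ω⁺ⱼ)
    Cℤ[K]a≈r₀ = proj₂ (Ω⁺-witness j {q₀} {r₀} q₀↦r₀ Ω⁺ⱼ)
    o = proj₁ (odd-part {suc j ℕ.+ s} {h} 2^[1+j+s]∥h)
    o-odd = proj₁ (proj₂ (odd-part {suc j ℕ.+ s} {h} 2^[1+j+s]∥h))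
    N = 2 ℕ.^ s ℕ.* o
    h≡KN+KN : h ≡ K ℕ.* N ℕ.+ K ℕ.* N
    h≡KN+KN = trans (proj₂ (proj₂ (odd-part {suc j ℕ.+ s} {h} 2^[1+j+s]∥h)))
                    (trans (cong (λ x → o ℕ.* (2 ℕ.* x)) (ℕP.^-distribˡ-+-* 2 j s)) (regroup o K (2 ℕ.^ s)))
      where regroup : ∀ o x y → o ℕ.* (2 ℕ.* (x ℕ.* y)) ≡ x ℕ.* (y ℕ.* o) ℕ.+ x ℕ.* (y ℕ.* o)
            regroup = ℕSolver.solve-∀
    open QuadraticExtension a using (X; ι; _^_)
    open QuadraticExtensionModulo m prime a using (_≋_; Cℤ≈0)
    X^[KN+KN]≋-1 : X ^ (K ℕ.* N ℕ.+ K ℕ.* N) ≋ ι (- 1ℤ)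
    X^[KN+KN]≋-1 = subst (λ n → X ^ n ≋ ι (- 1ℤ)) h≡KN+KN
      (X^p̂≋-1 a {q₀} {h} K π′ (δ↦Du² {q₀} {r₀} {a} K q₀↦r₀ Cℤ[K]a≈r₀)
                                (¬Ω⁺⇒nonsquare j {q₀} {r₀} {a} π′ q₀↦r₀ Cℤ[K]a≈r₀ ¬Ω⁺) hat)
    Cℤ[N]r₀≈0 : Cℤ N r₀ ≈ 0ℤ
    Cℤ[N]r₀≈0 = begin
      Cℤ N r₀              ≈⟨ Cℤ-congʳ N (≈-sym Cℤ[K]a≈r₀) ⟩
      Cℤ N (Cℤ K a)        ≡⟨ Cℤ-∘ N K a ⟩
      Cℤ (K ℕ.* N) a       ≈⟨ Cℤ≈0 (K ℕ.* N) X^[KN+KN]≋-1 ⟩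
      0ℤ                   ∎

open import Data.Nat using (ℕ; _+_; _≥_)
open import Data.Rational using (ℚ; _/_) renaming (_+_ to _+ℚ_; _-_ to _-ℚ_)
open import Data.Integer using (+_)
open import Relation.Nullary using (¬_)
open import Relation.Binary.PropositionalEquality using (refl)
open Parity using (odd⇒1+2*)

theorem14 : (q₀ : ℚ) → ¬ IsSquareℚ ((+ 2 / 1) +ℚ q₀) → ¬ IsSquareℚ ((+ 2 / 1) -ℚ q₀) →
    (k s : ℕ) → k ≥ 1 → (p h : ℕ) → Z k q₀ p → IsHat q₀ p h → (k + s) ∥ h →
    Π s q₀ p
theorem14 q₀ _ _ (suc j) s _ p h z hat 2^[k+s]∥h with proj₁ (Ω⇒Π′ plus j (proj₁ (proj₁ z)))
... | p-prime , p-odd with odd⇒1+2* p p-odd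
...   | m , refl = Inclusion.Z⇒Π m p-prime j s h z hat 2^[k+s]∥h
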